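{- Let $n=2k$ and let $\pi'=(a_1,b_1)(a_2,b_2)\cdots(a_k,b_k)\in\mathscr{I}'_n$ be a fixed-point-free involution written in standard form. Then $\mathcal{W}'(\pi')$ consists exactly of those $w=[w(1),\dots,w(n)]\in S_n$ such that (1) for each $i$, $a_i$ occurs before $b_i$ in $w$ and no value occurs between $b_i$ and $a_i$ in $w$; (2) if $i<j$ and $b_i<b_j$, then $b_i$ occurs before $a_j$ in $w$.
   Context: Permutations are written in one-line notation and multiplied right to left; $s_i=(i,i+1)$; $\ell$ is the Coxeter length (number of inversions). "$x$ occurs before $y$ in $w$" means $w^{ -1}(x)<w^{ -1}(y)$; "between" similarly. $\mathscr{I}'_n$ is the set of fixed-point-free involutions of $S_n$. Standard form: $\pi'=(a_1,b_1)\cdots(a_k,b_k)$ with $a_i<b_i$ and $a_1<\dots<a_k$. For $\pi'\in\mathscr{I}'_n$ define $m(s_i)\cdot\pi'=s_i\pi's_i$ if $\ell(s_i\pi's_i)=\ell(\pi')+2$, and $m(s_i)\cdot\pi'=\pi'$ otherwise; for $w\in S_n$ with reduced expression $w=s_{i_1}\cdots s_{i_r}$ put $m(w)\cdot\pi'=m(s_{i_1})\cdot(\cdots(m(s_{i_r})\cdot\pi'))$ (independent of the reduced expression). Let $\alpha'=(1,2)(3,4)\cdots(n-1,n)$. For $\pi'$ in standard form, $L'(\pi')$ is the number of inversions of the word $(a_1,b_1,a_2,b_2,\dots,a_k,b_k)$. The $\mathcal{W}$-set is $\mathcal{W}'(\pi')=\{w\in S_n: m(w)\cdot\alpha'=\pi'\text{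 and }\ell(w)=L'(\pi')\}$. -}

module Defs where

open import Data.Nat using (ℕ; zero; suc; _+_; _*_)
import Data.Nat as ℕ
open import Data.Fin using (Fin; zero; suc; toℕ; _<_; _<?_)
open import Data.Fin.Permutation.Components using (transpose)
open import Data.List using (List; []; _∷_; length; filter; map; allFin; concatMap)
open import Data.List.Relation.Unary.All using (All)
open import Data.Product using (Σ; ∃; ∃-syntax; _×_; _,_)
open import Data.Sum using (_⊎_)
open import Function using (_∘_; id)
open import Function.Definitions using (Injective)
open import Relation.Binary.PropositionalEquality using (_≡_; _≢_)
open import Relation.Nullary using (¬_; does)
open import Data.Bool using (if_then_else_)

-- Conventions: values and positions are 0-based (Fin n); a permutation
-- w ∈ S_n is a function w : Fin n → Fin n (one-line notation: w(p) is the
-- value at position p) which is injective (hence bijective).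

IsPerm : ∀ {n} → (Fin n → Fin n) → Set
IsPerm w = Injective _≡_ _≡_ w

_≐_ : ∀ {n} → (Fin n → Fin n) → (Fin n → Fin n) → Set
f ≐ g = ∀ x → f x ≡ g x

wordInv : List ℕ → ℕ
wordInv [] = 0
wordInv (x ∷ xs) = length (filter (λ y → y ℕ.<? x) xs) + wordInv xs

-- Coxeter length = number of inversions of the one-line notation
ℓ : ∀ {n} → (Fin n → Fin n) → ℕ
ℓ {n} w = wordInv (map (toℕ ∘ w) (allFin n))

IsFPFInvolution : ∀ {n} → (Fin n → Fin n) → Set
IsFPFInvolution π = (∀ x → π (π x) ≡ x) × (∀ x → π x ≢ x)

-- L'(π'): inversions of the word a₁ b₁ a₂ b₂ … a_k b_k, where the a_i are the
-- values x with x < π x listed increasingly and b_i = π a_i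
standardWord : ∀ {n} → (Fin n → Fin n) → List ℕ
standardWord {n} π =
  concatMap (λ a → toℕ a ∷ toℕ (π a) ∷ []) (filter (λ x → x <? π x) (allFin n))

L′ : ∀ {n} → (Fin n → Fin n) → ℕ
L′ π = wordInv (standardWord π)

-- a simple reflection s_i is given by the pair (i , i+1) of adjacent values
Adjacent : ∀ {n} → Fin n × Fin n → Set
Adjacent (i , j) = toℕ j ≡ suc (toℕ i)

sRefl : ∀ {n} → Fin n × Fin n → Fin n → Fin n
sRefl (i , j) = transpose i j

wordProd : ∀ {n} → List (Fin n × Fin n) → Fin n → Fin n
wordProd [] = id
wordProd (s ∷ ws) = sRefl s ∘ wordProd ws

mAct : ∀ {n} → Fin n × Fin n → (Fin n → Fin n) → (Fin n → Fin n)
mAct s π =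
  if does (ℓ (sRefl s ∘ π ∘ sRefl s) ℕ.≟ ℓ π + 2)
  then sRefl s ∘ π ∘ sRefl s
  else π

mWordAct : ∀ {n} → List (Fin n × Fin n) → (Fin n → Fin n) → (Fin n → Fin n)
mWordAct [] π = π
mWordAct (s ∷ ws) π = mAct s (mWordAct ws π)

IsReducedExpr : ∀ {n} → (Fin n → Fin n) → List (Fin n × Fin n) → Set
IsReducedExpr w ws = All Adjacent ws × wordProd ws ≐ w × length ws ≡ ℓ w

-- α' = (1,2)(3,4)⋯(n-1,n) on n = k·2 letters (0-based: (0,1)(2,3)⋯)
α′ : ∀ k → Fin (k * 2) → Fin (k * 2)
α′ zero ()
α′ (suc k) zero = suc zero
α′ (suc k) (suc zero) = zero
α′ (suc k) (suc (suc x)) = suc (suc (α′ k x))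

-- m(w)·α' = π', computed along a reduced expression of w
-- (independent of the reduced expression by the paper)
MActα′ : ∀ k → (w π : Fin (k * 2) → Fin (k * 2)) → Set
MActα′ k w π = ∃[ ws ] (IsReducedExpr w ws × mWordAct ws (α′ k) ≐ π)

InW′ : ∀ k → (π w : Fin (k * 2) → Fin (k * 2)) → Set
InW′ k π w = IsPerm w × MActα′ k w π × ℓ w ≡ L′ π

OccursBefore : ∀ {n} → (Fin n → Fin n) → Fin n → Fin n → Set
OccursBefore w x y = ∃[ p ] ∃[ q ] (w p ≡ x × w q ≡ y × p < q)

OccursBetween : ∀ {n} → (Fin n → Fin n) → Fin n → Fin n → Fin n → Set
OccursBetween w z x y =
  (OccursBefore w x z × OccursBefore w z y) ⊎ (OccursBefore w y z × OccursBefore w z x)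

Cond1 : ∀ {n} → (π w : Fin n → Fin n) → Set
Cond1 π w = ∀ a → a < π a →
  OccursBefore w a (π a) × (∀ z → ¬ OccursBetween w z (π a) a)

-- condition (2): i < j (i.e. a_i < a_j) and b_i < b_j ⇒ b_i occurs before a_j
Cond2 : ∀ {n} → (π w : Fin n → Fin n) → Set
Cond2 π w = ∀ a a′ → a < π a → a′ < π a′ → a < a′ → π a < π a′ →
  OccursBefore w (π a) a′

-- Group the positions into blocks {2j, 2j+1}, which α′ swaps. For a conjugator u (π ∘ u = u ∘ α′), the lengths
-- ℓ u, L′ π and ℓ π are sums over pairs of blocks j < j′ of quantities that depend only on the relative order of
-- the four values u(2j), u(2j+1), u(2j′), u(2j′+1), plus the descents inside blocks for ℓ u and one inversion per
-- block for ℓ π. Comparing these four-point quantities (a finite check) gives L′ π ≤ ℓ u, with equality exactly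
-- when every block increases and no later block lies entrywise below an earlier one; then also 2 ℓ u + k ≤ ℓ π.
--
-- Along a reduced word for w, the letters at which m acts by conjugation multiply to a conjugator u with
-- ℓ u ≤ ℓ w, so m(w)·α′ = π together with ℓ w = L′ π forces u = w and equality above. Conversely, for such a
-- conjugator w, conjugating α′ along a reduced word of w reaches π while raising ℓ by at most 2 per letter, and
-- 2 ℓ w + k ≤ ℓ π forces exactly 2 at each letter, which is when m acts. Condition (1) says that each pair
-- (a_i, b_i) of π occupies a block of positions of w, a_i first (so w is a conjugator with increasing blocks), and
-- (2) then says that no later block lies entrywise below an earlier one.

module Submission where

open import Defs
open import Data.Nat as ℕ using (ℕ; zero; suc; _+_; _*_; _≤_; _<_; z≤n; s≤s; _<ᵇ_; _≡ᵇ_; _≤ᵇ_)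
open import Data.Nat.Properties as NP hiding (_≟_; even≢odd)
open import Data.Nat.Solver using (module +-*-Solver)
open import Data.Fin as F using (Fin; zero; suc; toℕ; fromℕ<)
import Data.Fin.Properties as FP
open import Data.Fin.Permutation using (permutation)
open import Data.Fin.Permutation.Components using (transpose)
open import Data.Bool using (Bool; true; false; if_then_else_; T; _∧_; _∨_; not)
open import Data.List using (List; []; _∷_; length; filter; allFin; concatMap; tabulate; _++_)
open import Data.List.Properties using (map-tabulate)
open import Data.List.Relation.Unary.All using (All; []; _∷_)
open import Data.Product
open import Data.Sum
open import Data.Empty
open import Data.Unit using (tt; ⊤)
open import Function using (_∘_; id)
open import Function.Bundles using (_⇔_; mk⇔)
open import Function.Definitions using (Injective)
open import Level using (0ℓ)
open import Relation.Binary using (tri<; tri≈; tri>)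
open import Relation.Binary.PropositionalEquality
open import Relation.Nullary
open import Relation.Nullary.Decidable using (_×-dec_; dec-true; dec-false)
open import Relation.Unary using (Pred)
open import Algebra.Properties.CommutativeMonoid.Sum NP.+-0-commutativeMonoid using (sum; sum-permute; sum-cong-≗)
open import Algebra.Properties.CommutativeSemigroup NP.+-commutativeSemigroup using () renaming (interchange to +-interchange)
open +-*-Solver using (solve; _:+_; _:*_; _:=_)

χ< : ℕ → ℕ → ℕ
χ< a b = if a <ᵇ b then 1 else 0

χ≡ : ℕ → ℕ → ℕ
χ≡ a b = if a ≡ᵇ b then 1 else 0

T⇒≡true : ∀ {b} → T b → b ≡ true
T⇒≡true {true} _ = refl

¬T⇒≡false : ∀ {b} → ¬ T b → b ≡ false
¬T⇒≡false {true} n = ⊥-elim (n tt)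
¬T⇒≡false {false} _ = refl

χ<≡1 : ∀ {a b} → a < b → χ< a b ≡ 1
χ<≡1 {a} {b} p rewrite T⇒≡true (<⇒<ᵇ p) = refl

χ<≡0 : ∀ {a b} → b ≤ a → χ< a b ≡ 0
χ<≡0 {a} {b} p rewrite ¬T⇒≡false {a <ᵇ b} (λ t → ≤⇒≯ p (<ᵇ⇒< a b t)) = refl

χ<-cases : ∀ a b → (a < b × χ< a b ≡ 1) ⊎ (b ≤ a × χ< a b ≡ 0)
χ<-cases a b with a ℕ.<? b
... | yes p = inj₁ (p , χ<≡1 p)
... | no p = inj₂ (≮⇒≥ p , χ<≡0 (≮⇒≥ p))

χ<≤1 : ∀ a b → χ< a b ≤ 1
χ<≤1 a b with χ<-cases a b
... | inj₁ (_ , e) rewrite e = ≤-refl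
... | inj₂ (_ , e) rewrite e = z≤n

χ<-irrefl : ∀ a → χ< a a ≡ 0
χ<-irrefl a = χ<≡0 {a} {a} ≤-refl

χ<-irrefl-* : ∀ a b → χ< a a * b ≡ 0
χ<-irrefl-* a b rewrite χ<-irrefl a = refl

*-χ<-irrefl : ∀ c a → c * χ< a a ≡ 0
*-χ<-irrefl c a rewrite χ<-irrefl a = *-zeroʳ c

χ<-asym : ∀ a b → χ< a b * χ< b a ≡ 0
χ<-asym a b with χ<-cases a b
... | inj₂ (_ , e) rewrite e = refl
... | inj₁ (p , e) rewrite e | χ<≡0 (<⇒≤ p) = refl

χ<≡1⇒< : ∀ {a b} → χ< a b ≡ 1 → a < b
χ<≡1⇒< {a} {b} e with χ<-cases a b
... | inj₁ (p , _) = p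
... | inj₂ (_ , e') = ⊥-elim (0≢1+n (trans (sym e') e))

χ≡-refl : ∀ a → χ≡ a a ≡ 1
χ≡-refl a rewrite T⇒≡true (≡⇒≡ᵇ a a refl) = refl

χ≡-≢ : ∀ {a b} → a ≢ b → χ≡ a b ≡ 0
χ≡-≢ {a} {b} ne rewrite ¬T⇒≡false {a ≡ᵇ b} (λ t → ne (≡ᵇ⇒≡ a b t)) = refl

χ≡-sym : ∀ a b → χ≡ a b ≡ χ≡ b a
χ≡-sym a b with a ℕ.≟ b
... | yes refl = refl
... | no ne rewrite χ≡-≢ ne | χ≡-≢ (ne ∘ sym) = refl

χ<-connex : ∀ {a b} → a ≢ b → χ< a b + χ< b a ≡ 1
χ<-connex {a} {b} ne with χ<-cases a b | χ<-cases b a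
... | inj₁ (p , e) | inj₁ (q , e') = ⊥-elim (<-asym p q)
... | inj₁ (p , e) | inj₂ (q , e') rewrite e | e' = refl
... | inj₂ (p , e) | inj₁ (q , e') rewrite e | e' = refl
... | inj₂ (p , e) | inj₂ (q , e') = ⊥-elim (ne (≤-antisym q p))

χ<-trichotomy : ∀ a b → χ< a b + χ< b a + χ≡ a b ≡ 1
χ<-trichotomy a b with <-cmp a b
... | tri< p ne _ rewrite χ<≡1 p | χ<≡0 {b} {a} (<⇒≤ p) | χ≡-≢ ne = refl
... | tri> _ ne p rewrite χ<≡1 p | χ<≡0 {a} {b} (<⇒≤ p) | χ≡-≢ ne = refl
... | tri≈ _ refl _ rewrite χ<-irrefl a | χ≡-refl a = refl

χ<ᶠ : ∀ {n} → Fin n → Fin n → ℕ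
χ<ᶠ p q = χ< (toℕ p) (toℕ q)

δ : ∀ {n} → Fin n → Fin n → ℕ
δ p q = χ≡ (toℕ p) (toℕ q)

δ-self : ∀ {n} (i : Fin n) → δ i i ≡ 1
δ-self i = χ≡-refl (toℕ i)

δ-≢ : ∀ {n} {i l : Fin n} → i ≢ l → δ i l ≡ 0
δ-≢ {i = i} {l} ne = χ≡-≢ (λ e → ne (FP.toℕ-injective e))

perm-surjective : ∀ {n} (w : Fin n → Fin n) → IsPerm w → ∀ y → ∃ λ p → w p ≡ y
perm-surjective {n} w inj y with FP.any? (λ p → w p FP.≟ y)
... | yes e = e
perm-surjective {suc m} w inj y | no ne = ⊥-elim (noCollision (FP.pigeonhole (n<1+n m) squeeze))
  where
  squeeze : Fin (suc m) → Fin m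
  squeeze p = F.punchOut {i = y} {j = w p} (λ e → ne (p , sym e))
  noCollision : ¬ (∃₂ λ i j → i F.< j × squeeze i ≡ squeeze j)
  noCollision (i , j , i<j , e) =
    <-irrefl (cong toℕ (inj (FP.punchOut-injective (λ e → ne (i , sym e)) (λ e → ne (j , sym e)) e))) i<j

inverse : ∀ {n} (w : Fin n → Fin n) → IsPerm w → Fin n → Fin n
inverse w inj y = proj₁ (perm-surjective w inj y)

inverseʳ : ∀ {n} (w : Fin n → Fin n) (inj : IsPerm w) y → w (inverse w inj y) ≡ y
inverseʳ w inj y = proj₂ (perm-surjective w inj y)

inverseˡ : ∀ {n} (w : Fin n → Fin n) (inj : IsPerm w) p → inverse w inj (w p) ≡ p
inverseˡ w inj p = inj (inverseʳ w inj (w p))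

IsPerm-∘ : ∀ {n} {f g : Fin n → Fin n} → IsPerm f → IsPerm g → IsPerm (f ∘ g)
IsPerm-∘ fi gi e = gi (fi e)

≐-from-image : ∀ {n} {f g u : Fin n → Fin n} → IsPerm u → (∀ p → f (u p) ≡ g (u p)) → f ≐ g
≐-from-image {f = f} {g} {u} u-perm h y = subst (λ z → f z ≡ g z) (inverseʳ u u-perm y) (h (inverse u u-perm y))

opaque
  ∑ : ∀ {n} → (Fin n → ℕ) → ℕ
  ∑ = sum

opaque
  unfolding ∑

  ∑-empty : ∀ (f : Fin 0 → ℕ) → ∑ f ≡ 0
  ∑-empty f = refl

  ∑-suc : ∀ {n} (f : Fin (suc n) → ℕ) → ∑ f ≡ f zero + ∑ (f ∘ suc)
  ∑-suc f = refl

  ∑-cong : ∀ {n} {f g : Fin n → ℕ} → (∀ i → f i ≡ g i) → ∑ f ≡ ∑ g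
  ∑-cong = sum-cong-≗

  ∑-permute : ∀ {n} (w : Fin n → Fin n) → IsPerm w → (f : Fin n → ℕ) → ∑ f ≡ ∑ (f ∘ w)
  ∑-permute w inj f = sum-permute f (permutation w (inverse w inj) (inverseʳ w inj) (inverseˡ w inj))

∑-mono-≤ : ∀ {n} {f g : Fin n → ℕ} → (∀ i → f i ≤ g i) → ∑ f ≤ ∑ g
∑-mono-≤ {zero} {f} {g} h rewrite ∑-empty f | ∑-empty g = z≤n
∑-mono-≤ {suc n} {f} {g} h rewrite ∑-suc f | ∑-suc g = +-mono-≤ (h zero) (∑-mono-≤ (h ∘ suc))

∑-distrib-+ : ∀ {n} (f g : Fin n → ℕ) → ∑ (λ i → f i + g i) ≡ ∑ f + ∑ g
∑-distrib-+ {zero} f g rewrite ∑-empty f | ∑-empty g | ∑-empty (λ i → f i + g i) = refl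
∑-distrib-+ {suc n} f g rewrite ∑-suc f | ∑-suc g | ∑-suc (λ i → f i + g i) | ∑-distrib-+ (f ∘ suc) (g ∘ suc) =
  +-interchange (f zero) (g zero) (∑ (f ∘ suc)) (∑ (g ∘ suc))

∑-zeros : ∀ {n} → ∑ {n} (λ _ → 0) ≡ 0
∑-zeros {zero} = ∑-empty _
∑-zeros {suc n} = trans (∑-suc _) (∑-zeros {n})

∑-ones : ∀ {n} → ∑ {n} (λ _ → 1) ≡ n
∑-ones {zero} = ∑-empty _
∑-ones {suc n} = trans (∑-suc _) (cong suc (∑-ones {n}))

∑-comm : ∀ {m n} (f : Fin m → Fin n → ℕ) → ∑ (λ i → ∑ (λ j → f i j)) ≡ ∑ (λ j → ∑ (λ i → f i j))
∑-comm {zero} {n} f = trans (∑-empty _) (trans (sym (∑-zeros {n})) (∑-cong (λ j → sym (∑-empty _))))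
∑-comm {suc m} {n} f = begin
    ∑ (λ i → ∑ (λ j → f i j))
      ≡⟨ ∑-suc _ ⟩
    ∑ (f zero) + ∑ (λ i → ∑ (λ j → f (suc i) j))
      ≡⟨ cong (∑ (f zero) +_) (∑-comm (f ∘ suc)) ⟩
    ∑ (f zero) + ∑ (λ j → ∑ (λ i → f (suc i) j))
      ≡⟨ sym (∑-distrib-+ (f zero) (λ j → ∑ (λ i → f (suc i) j))) ⟩
    ∑ (λ j → f zero j + ∑ (λ i → f (suc i) j))
      ≡⟨ ∑-cong (λ j → sym (∑-suc (λ i → f i j))) ⟩
    ∑ (λ j → ∑ (λ i → f i j)) ∎
  where open ≡-Reasoning

∑-*ˡ : ∀ {n} c (f : Fin n → ℕ) → ∑ (λ i → c * f i) ≡ c * ∑ f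
∑-*ˡ {zero} c f rewrite ∑-empty f | ∑-empty (λ i → c * f i) = sym (*-zeroʳ c)
∑-*ˡ {suc n} c f rewrite ∑-suc f | ∑-suc (λ i → c * f i) | ∑-*ˡ c (f ∘ suc) = sym (*-distribˡ-+ c (f zero) _)

+-mono-≤-equality : ∀ {a b c d} → a ≤ b → c ≤ d → a + c ≡ b + d → a ≡ b × c ≡ d
+-mono-≤-equality {a} {b} {c} {d} p q e =
  let ab = ≤-antisym p (+-cancelʳ-≤ c b a (≤-trans (+-monoʳ-≤ b q) (≤-reflexive (sym e))))
  in ab , +-cancelˡ-≡ a c d (trans e (cong (_+ d) (sym ab)))

∑-mono-≤-equality : ∀ {n} {f g : Fin n → ℕ} → (∀ i → f i ≤ g i) → ∑ f ≡ ∑ g → ∀ i → f i ≡ g i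
∑-mono-≤-equality {suc n} {f} {g} h e i
  with +-mono-≤-equality (h zero) (∑-mono-≤ (h ∘ suc)) (trans (sym (∑-suc f)) (trans e (∑-suc g)))
∑-mono-≤-equality {suc n} {f} {g} h e zero | e0 , _ = e0
∑-mono-≤-equality {suc n} {f} {g} h e (suc i) | _ , e1 = ∑-mono-≤-equality (h ∘ suc) e1 i

∑-δ : ∀ {n} (a : Fin n) (f : Fin n → ℕ) → ∑ (λ i → δ a i * f i) ≡ f a
∑-δ {suc n} zero f = trans (∑-suc _) (trans (cong₂ _+_ (*-identityˡ (f zero)) (∑-zeros {n})) (+-identityʳ _))
∑-δ {suc n} (suc a) f = trans (∑-suc _) (∑-δ a (f ∘ suc))

∑δ≡1 : ∀ {n} (i : Fin n) → ∑ (δ i) ≡ 1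
∑δ≡1 i = trans (∑-cong (λ l → sym (*-identityʳ (δ i l)))) (∑-δ i (λ _ → 1))

∑-mono-< : ∀ {n} {f g : Fin n → ℕ} (i : Fin n) → (∀ l → f l ≤ g l) → f i < g i → ∑ f < ∑ g
∑-mono-< {f = f} {g} i h hi =
  subst (_≤ ∑ g) (trans (∑-distrib-+ f (δ i)) (trans (cong (∑ f +_) (∑δ≡1 i)) (+-comm (∑ f) 1))) (∑-mono-≤ bumped)
  where
  bumped : ∀ l → f l + δ i l ≤ g l
  bumped l with i FP.≟ l
  ... | yes refl rewrite δ-self i = subst (_≤ g i) (+-comm 1 (f i)) hi
  ... | no ne rewrite δ-≢ ne = subst (_≤ g l) (sym (+-identityʳ (f l))) (h l)

∑∑-triangle : ∀ {n} (G : Fin n → Fin n → ℕ) →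
  ∑ (λ p → ∑ (λ q → G p q)) ≡ ∑ (λ p → ∑ (λ q → χ<ᶠ p q * (G p q + G q p))) + ∑ (λ p → G p p)
∑∑-triangle G = begin
    ∑ (λ p → ∑ (λ q → G p q))
      ≡⟨ ∑-cong (λ p → ∑-cong (λ q → pw p q)) ⟩
    ∑ (λ p → ∑ (λ q → (χ<ᶠ p q * G p q + χ<ᶠ q p * G p q) + δ p q * G p q))
      ≡⟨ ∑-cong (λ p → trans (∑-distrib-+ _ _) (cong₂ _+_ (∑-distrib-+ _ _) (∑-δ p (G p)))) ⟩
    ∑ (λ p → (∑ (λ q → χ<ᶠ p q * G p q) + ∑ (λ q → χ<ᶠ q p * G p q)) + G p p)
      ≡⟨ trans (∑-distrib-+ _ _) (cong (_+ ∑ (λ p → G p p)) (∑-distrib-+ _ _)) ⟩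
    (∑ (λ p → ∑ (λ q → χ<ᶠ p q * G p q)) + ∑ (λ p → ∑ (λ q → χ<ᶠ q p * G p q))) + ∑ (λ p → G p p)
      ≡⟨ cong (λ z → (∑ (λ p → ∑ (λ q → χ<ᶠ p q * G p q)) + z) + ∑ (λ p → G p p)) (∑-comm (λ p q → χ<ᶠ q p * G p q)) ⟩
    (∑ (λ p → ∑ (λ q → χ<ᶠ p q * G p q)) + ∑ (λ q → ∑ (λ p → χ<ᶠ q p * G p q))) + ∑ (λ p → G p p)
      ≡⟨ cong (_+ ∑ (λ p → G p p)) (sym (trans (∑-cong (λ p → trans (∑-cong (λ q → *-distribˡ-+ (χ<ᶠ p q) (G p q) (G q p)))
                                                                 (∑-distrib-+ _ _)))
                                               (∑-distrib-+ _ _))) ⟩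
    ∑ (λ p → ∑ (λ q → χ<ᶠ p q * (G p q + G q p))) + ∑ (λ p → G p p) ∎
  where
  open ≡-Reasoning
  pw : ∀ p q → G p q ≡ (χ<ᶠ p q * G p q + χ<ᶠ q p * G p q) + δ p q * G p q
  pw p q = sym (trans (cong (_+ δ p q * G p q) (sym (*-distribʳ-+ (G p q) (χ<ᶠ p q) (χ<ᶠ q p))))
            (trans (sym (*-distribʳ-+ (G p q) (χ<ᶠ p q + χ<ᶠ q p) (δ p q)))
              (trans (cong (_* G p q) (χ<-trichotomy (toℕ p) (toℕ q))) (*-identityˡ (G p q)))))

-- Inversion counts as double sums

∑ᴸ : ∀ {A : Set} → (A → ℕ) → List A → ℕ
∑ᴸ f [] = 0
∑ᴸ f (x ∷ xs) = f x + ∑ᴸ f xs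

∑ᴸ-pairs : ∀ {A : Set} → (A → A → ℕ) → List A → ℕ
∑ᴸ-pairs F [] = 0
∑ᴸ-pairs F (x ∷ xs) = ∑ᴸ (F x) xs + ∑ᴸ-pairs F xs

countBelow : ℕ → List ℕ → ℕ
countBelow c ys = length (filter (λ y → y ℕ.<? c) ys)

countBelow-∷ : ∀ c y ys → countBelow c (y ∷ ys) ≡ χ< y c + countBelow c ys
countBelow-∷ c y ys with y <ᵇ c
... | true = refl
... | false = refl

countBelow≡∑ᴸ : ∀ c ys → countBelow c ys ≡ ∑ᴸ (λ y → χ< y c) ys
countBelow≡∑ᴸ c [] = refl
countBelow≡∑ᴸ c (y ∷ ys) = trans (countBelow-∷ c y ys) (cong (χ< y c +_) (countBelow≡∑ᴸ c ys))

wordInv≡∑ᴸ-pairs : ∀ xs → wordInv xs ≡ ∑ᴸ-pairs (λ x y → χ< y x) xs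
wordInv≡∑ᴸ-pairs [] = refl
wordInv≡∑ᴸ-pairs (x ∷ xs) = cong₂ _+_ (countBelow≡∑ᴸ x xs) (wordInv≡∑ᴸ-pairs xs)

∑ᴸ-tabulate : ∀ {A : Set} {n} (f : A → ℕ) (h : Fin n → A) → ∑ᴸ f (tabulate h) ≡ ∑ (f ∘ h)
∑ᴸ-tabulate {n = zero} f h = sym (∑-empty _)
∑ᴸ-tabulate {n = suc n} f h = trans (cong (f (h zero) +_) (∑ᴸ-tabulate f (h ∘ suc))) (sym (∑-suc _))

∑ᴸ-pairs-tabulate : ∀ {A : Set} {n} (F : A → A → ℕ) (h : Fin n → A) →
  ∑ᴸ-pairs F (tabulate h) ≡ ∑ (λ a → ∑ (λ a' → χ<ᶠ a a' * F (h a) (h a')))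
∑ᴸ-pairs-tabulate {n = zero} F h = sym (∑-empty _)
∑ᴸ-pairs-tabulate {n = suc n} F h = begin
    ∑ᴸ (F (h zero)) (tabulate (h ∘ suc)) + ∑ᴸ-pairs F (tabulate (h ∘ suc))
      ≡⟨ cong₂ _+_ (trans (∑ᴸ-tabulate (F (h zero)) (h ∘ suc)) (∑-cong (λ i → sym (+-identityʳ _)))) (∑ᴸ-pairs-tabulate F (h ∘ suc)) ⟩
    ∑ (λ a' → χ<ᶠ {suc n} zero (suc a') * F (h zero) (h (suc a')))
      + ∑ (λ a → ∑ (λ a' → χ<ᶠ a a' * F (h (suc a)) (h (suc a'))))
      ≡⟨ cong₂ _+_ (sym (∑-suc (λ a' → χ<ᶠ zero a' * F (h zero) (h a'))))
                   (∑-cong (λ a → sym (∑-suc (λ a' → χ<ᶠ (suc a) a' * F (h (suc a)) (h a'))))) ⟩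
    ∑ (λ a' → χ<ᶠ zero a' * F (h zero) (h a')) + ∑ (λ a → ∑ (λ a' → χ<ᶠ (suc a) a' * F (h (suc a)) (h a')))
      ≡⟨ sym (∑-suc (λ a → ∑ (λ a' → χ<ᶠ a a' * F (h a) (h a')))) ⟩
    ∑ (λ a → ∑ (λ a' → χ<ᶠ a a' * F (h a) (h a'))) ∎
  where open ≡-Reasoning

ℓ≡∑inversions : ∀ {n} (w : Fin n → Fin n) → ℓ w ≡ ∑ (λ p → ∑ (λ q → χ<ᶠ p q * χ< (toℕ (w q)) (toℕ (w p))))
ℓ≡∑inversions {n} w = trans (cong wordInv (map-tabulate id (toℕ ∘ w)))
  (trans (wordInv≡∑ᴸ-pairs (tabulate (toℕ ∘ w))) (∑ᴸ-pairs-tabulate (λ x y → χ< y x) (toℕ ∘ w)))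

ℓ-cong : ∀ {n} {f g : Fin n → Fin n} → f ≐ g → ℓ f ≡ ℓ g
ℓ-cong {f = f} {g} e = trans (ℓ≡∑inversions f)
  (trans (∑-cong (λ p → ∑-cong (λ q → cong₂ (λ x y → χ<ᶠ p q * χ< (toℕ x) (toℕ y)) (e q) (e p)))) (sym (ℓ≡∑inversions g)))

ℓ-id : ∀ {n} → ℓ {n} id ≡ 0
ℓ-id {n} = trans (ℓ≡∑inversions {n} id) (trans (∑-cong (λ p → trans (∑-cong (λ q → χ<-asym (toℕ p) (toℕ q))) ∑-zeros)) ∑-zeros)

indicator : ∀ {A : Set} {P : Pred A 0ℓ} → Relation.Unary.Decidable P → A → ℕ
indicator P? x = if does (P? x) then 1 else 0

∑ᴸ-filter : ∀ {A : Set} {P : Pred A 0ℓ} (P? : Relation.Unary.Decidable P) (f : A → ℕ) xs →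
  ∑ᴸ f (filter P? xs) ≡ ∑ᴸ (λ x → indicator P? x * f x) xs
∑ᴸ-filter P? f [] = refl
∑ᴸ-filter P? f (x ∷ xs) with does (P? x)
... | true = cong₂ _+_ (sym (+-identityʳ (f x))) (∑ᴸ-filter P? f xs)
... | false = ∑ᴸ-filter P? f xs

∑ᴸ-zeros : ∀ {A : Set} (f : A → ℕ) xs → (∀ x → f x ≡ 0) → ∑ᴸ f xs ≡ 0
∑ᴸ-zeros f [] h = refl
∑ᴸ-zeros f (x ∷ xs) h rewrite h x = ∑ᴸ-zeros f xs h

∑ᴸ-cong : ∀ {A : Set} {f g : A → ℕ} xs → (∀ x → f x ≡ g x) → ∑ᴸ f xs ≡ ∑ᴸ g xs
∑ᴸ-cong [] h = refl
∑ᴸ-cong (x ∷ xs) h = cong₂ _+_ (h x) (∑ᴸ-cong xs h)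

∑ᴸ-pairs-filter : ∀ {A : Set} {P : Pred A 0ℓ} (P? : Relation.Unary.Decidable P) (F : A → A → ℕ) xs →
  ∑ᴸ-pairs F (filter P? xs) ≡ ∑ᴸ-pairs (λ x y → indicator P? x * (indicator P? y * F x y)) xs
∑ᴸ-pairs-filter P? F [] = refl
∑ᴸ-pairs-filter P? F (x ∷ xs) with does (P? x)
... | true = cong₂ _+_ (trans (∑ᴸ-filter P? (F x) xs) (∑ᴸ-cong xs (λ y → sym (+-identityʳ _)))) (∑ᴸ-pairs-filter P? F xs)
... | false = trans (∑ᴸ-pairs-filter P? F xs)
  (sym (cong (_+ ∑ᴸ-pairs (λ x y → indicator P? x * (indicator P? y * F x y)) xs) (∑ᴸ-zeros (λ _ → 0) xs (λ _ → refl))))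

∑ᴸ-distrib-+ : ∀ {A : Set} (f g : A → ℕ) xs → ∑ᴸ (λ x → f x + g x) xs ≡ ∑ᴸ f xs + ∑ᴸ g xs
∑ᴸ-distrib-+ f g [] = refl
∑ᴸ-distrib-+ f g (x ∷ xs) rewrite ∑ᴸ-distrib-+ f g xs = +-interchange (f x) (g x) (∑ᴸ f xs) (∑ᴸ g xs)

countBelow-++ : ∀ c xs ys → countBelow c (xs ++ ys) ≡ countBelow c xs + countBelow c ys
countBelow-++ c [] ys = refl
countBelow-++ c (x ∷ xs) ys = begin
    countBelow c (x ∷ xs ++ ys)                   ≡⟨ countBelow-∷ c x (xs ++ ys) ⟩
    χ< x c + countBelow c (xs ++ ys)              ≡⟨ cong (χ< x c +_) (countBelow-++ c xs ys) ⟩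
    χ< x c + (countBelow c xs + countBelow c ys)  ≡⟨ sym (+-assoc (χ< x c) _ _) ⟩
    χ< x c + countBelow c xs + countBelow c ys    ≡⟨ cong (_+ countBelow c ys) (sym (countBelow-∷ c x xs)) ⟩
    countBelow c (x ∷ xs) + countBelow c ys       ∎
  where open ≡-Reasoning

module StandardWord {n} (π : Fin n → Fin n) where
  pairWord : Fin n → List ℕ
  pairWord a = toℕ a ∷ toℕ (π a) ∷ []

  countBelow-concatMap : ∀ c as → countBelow c (concatMap pairWord as) ≡ ∑ᴸ (λ a → χ< (toℕ a) c + χ< (toℕ (π a)) c) as
  countBelow-concatMap c [] = refl
  countBelow-concatMap c (a ∷ as) = trans (countBelow-++ c (pairWord a) (concatMap pairWord as))
    (cong₂ _+_ (trans (countBelow-∷ c _ _) (cong (χ< (toℕ a) c +_) (trans (countBelow-∷ c _ _) (+-identityʳ _)))) (countBelow-concatMap c as))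

  pairInversions : Fin n → Fin n → ℕ
  pairInversions a a' = (χ< (toℕ a') (toℕ a) + χ< (toℕ (π a')) (toℕ a)) + (χ< (toℕ a') (toℕ (π a)) + χ< (toℕ (π a')) (toℕ (π a)))

  wordInv-concatMap : ∀ as → wordInv (concatMap pairWord as) ≡ ∑ᴸ (λ a → χ< (toℕ (π a)) (toℕ a)) as + ∑ᴸ-pairs pairInversions as
  wordInv-concatMap [] = refl
  wordInv-concatMap (a ∷ as) =
    let R = concatMap pairWord as
        x = toℕ a
        y = toℕ (π a)
    in begin
      countBelow x (y ∷ R) + (countBelow y R + wordInv R)
        ≡⟨ cong₂ (λ u v → u + (countBelow y R + v)) (countBelow-∷ x y R) (wordInv-concatMap as) ⟩
      (χ< y x + countBelow x R) + (countBelow y R + (∑ᴸ (λ a → χ< (toℕ (π a)) (toℕ a)) as + ∑ᴸ-pairs pairInversions as))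
        ≡⟨ regroup (χ< y x) (countBelow x R) (countBelow y R) (∑ᴸ (λ a → χ< (toℕ (π a)) (toℕ a)) as) (∑ᴸ-pairs pairInversions as) ⟩
      (χ< y x + ∑ᴸ (λ a → χ< (toℕ (π a)) (toℕ a)) as) + ((countBelow x R + countBelow y R) + ∑ᴸ-pairs pairInversions as)
        ≡⟨ cong (λ u → (χ< y x + ∑ᴸ (λ a → χ< (toℕ (π a)) (toℕ a)) as) + (u + ∑ᴸ-pairs pairInversions as))
             (trans (cong₂ _+_ (countBelow-concatMap x as) (countBelow-concatMap y as)) (sym (∑ᴸ-distrib-+ _ _ as))) ⟩
      (χ< y x + ∑ᴸ (λ a → χ< (toℕ (π a)) (toℕ a)) as) + (∑ᴸ (pairInversions a) as + ∑ᴸ-pairs pairInversions as) ∎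
    where
    open ≡-Reasoning
    regroup : ∀ X A B s p → (X + A) + (B + (s + p)) ≡ (X + s) + ((A + B) + p)
    regroup = solve 5 (λ X A B s p → (X :+ A) :+ (B :+ (s :+ p)) := (X :+ s) :+ ((A :+ B) :+ p)) refl

  opens? : Relation.Unary.Decidable (λ x → x F.< π x)
  opens? x = x F.<? π x

  L′≡∑ : L′ π ≡ ∑ (λ a → indicator opens? a * χ< (toℕ (π a)) (toℕ a))
               + ∑ (λ a → ∑ (λ a' → χ<ᶠ a a' * (indicator opens? a * (indicator opens? a' * pairInversions a a'))))
  L′≡∑ = trans (wordInv-concatMap (filter opens? (allFin n)))
    (cong₂ _+_ (trans (∑ᴸ-filter opens? (λ a → χ< (toℕ (π a)) (toℕ a)) (allFin n))
                      (∑ᴸ-tabulate (λ x → indicator opens? x * χ< (toℕ (π x)) (toℕ x)) id))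
               (trans (∑ᴸ-pairs-filter opens? pairInversions (allFin n))
                      (∑ᴸ-pairs-tabulate (λ x y → indicator opens? x * (indicator opens? y * pairInversions x y)) id)))

-- Blocks of positions

even odd : ∀ {k} → Fin k → Fin (k * 2)
even {suc k} zero = zero
even {suc k} (suc j) = suc (suc (even j))
odd {suc k} zero = suc zero
odd {suc k} (suc j) = suc (suc (odd j))

toℕ-even : ∀ {k} (j : Fin k) → toℕ (even j) ≡ toℕ j + toℕ j
toℕ-even {suc k} zero = refl
toℕ-even {suc k} (suc j) = trans (cong (λ x → ℕ.suc (ℕ.suc x)) (toℕ-even j)) (cong ℕ.suc (sym (+-suc (toℕ j) (toℕ j))))

toℕ-odd : ∀ {k} (j : Fin k) → toℕ (odd j) ≡ suc (toℕ j + toℕ j)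
toℕ-odd {suc k} zero = refl
toℕ-odd {suc k} (suc j) = trans (cong (λ x → ℕ.suc (ℕ.suc x)) (toℕ-odd j)) (cong (λ x → ℕ.suc (ℕ.suc x)) (sym (+-suc (toℕ j) (toℕ j))))

∑-even-odd : ∀ {k} (f : Fin (k * 2) → ℕ) → ∑ f ≡ ∑ {k} (λ j → f (even j) + f (odd j))
∑-even-odd {zero} f = trans (∑-empty f) (sym (∑-empty (λ j → f (even j) + f (odd j))))
∑-even-odd {suc k} f = begin
    ∑ f ≡⟨ ∑-suc f ⟩
    f zero + ∑ (f ∘ F.suc) ≡⟨ cong (f zero +_) (∑-suc (f ∘ F.suc)) ⟩
    f zero + (f (F.suc zero) + ∑ (λ x → f (F.suc (F.suc x)))) ≡⟨ sym (+-assoc (f zero) (f (F.suc zero)) _) ⟩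
    f zero + f (F.suc zero) + ∑ (λ x → f (F.suc (F.suc x))) ≡⟨ cong (f zero + f (F.suc zero) +_) (∑-even-odd {k} (λ x → f (F.suc (F.suc x)))) ⟩
    f zero + f (F.suc zero) + ∑ (λ j → f (even (F.suc j)) + f (odd (F.suc j))) ≡⟨ sym (∑-suc (λ j → f (even j) + f (odd j))) ⟩
    ∑ (λ j → f (even j) + f (odd j)) ∎
  where open ≡-Reasoning

α′-even : ∀ {k} (j : Fin k) → α′ k (even j) ≡ odd j
α′-even {suc k} zero = refl
α′-even {suc k} (suc j) = cong (λ x → F.suc (F.suc x)) (α′-even j)

α′-odd : ∀ {k} (j : Fin k) → α′ k (odd j) ≡ even j
α′-odd {suc k} zero = refl
α′-odd {suc k} (suc j) = cong (λ x → F.suc (F.suc x)) (α′-odd j)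

even-or-odd : ∀ {k} (p : Fin (k * 2)) → ∃ λ (j : Fin k) → (p ≡ even j) ⊎ (p ≡ odd j)
even-or-odd {suc k} zero = zero , inj₁ refl
even-or-odd {suc k} (suc zero) = zero , inj₂ refl
even-or-odd {suc k} (suc (suc p)) with even-or-odd {k} p
... | j , inj₁ e = suc j , inj₁ (cong (λ x → F.suc (F.suc x)) e)
... | j , inj₂ e = suc j , inj₂ (cong (λ x → F.suc (F.suc x)) e)

α′-involutive : ∀ k (p : Fin (k * 2)) → α′ k (α′ k p) ≡ p
α′-involutive (suc k) zero = refl
α′-involutive (suc k) (suc zero) = refl
α′-involutive (suc k) (suc (suc p)) = cong (λ x → F.suc (F.suc x)) (α′-involutive k p)

α′-perm : ∀ k → IsPerm (α′ k)
α′-perm k {x} {y} e = trans (sym (α′-involutive k x)) (trans (cong (α′ k) e) (α′-involutive k y))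

χ<-double : ∀ a b → χ< (a + a) (b + b) ≡ χ< a b
χ<-double zero zero = refl
χ<-double zero (suc b) = refl
χ<-double (suc a) zero = refl
χ<-double (suc a) (suc b) rewrite +-suc a a | +-suc b b = χ<-double a b

χ<-double-suc : ∀ a b → χ< (a + a) (suc (b + b)) ≡ χ< a b + χ≡ a b
χ<-double-suc zero zero = refl
χ<-double-suc zero (suc b) = refl
χ<-double-suc (suc a) zero = refl
χ<-double-suc (suc a) (suc b) rewrite +-suc a a | +-suc b b = χ<-double-suc a b

χ<-suc-double : ∀ a b → χ< (suc (a + a)) (b + b) ≡ χ< a b
χ<-suc-double zero zero = refl
χ<-suc-double zero (suc b) rewrite +-suc b b = refl
χ<-suc-double (suc a) zero = refl
χ<-suc-double (suc a) (suc b) rewrite +-suc a a | +-suc b b = χ<-suc-double a b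

χ<-suc-double-suc : ∀ a b → χ< (suc (a + a)) (suc (b + b)) ≡ χ< a b
χ<-suc-double-suc a b = χ<-double a b

χ<ᶠ-even-even : ∀ {k} (j j' : Fin k) → χ<ᶠ (even j) (even j') ≡ χ<ᶠ j j'
χ<ᶠ-even-even j j' rewrite toℕ-even j | toℕ-even j' = χ<-double (toℕ j) (toℕ j')
χ<ᶠ-even-odd : ∀ {k} (j j' : Fin k) → χ<ᶠ (even j) (odd j') ≡ χ<ᶠ j j' + δ j j'
χ<ᶠ-even-odd j j' rewrite toℕ-even j | toℕ-odd j' = χ<-double-suc (toℕ j) (toℕ j')
χ<ᶠ-odd-even : ∀ {k} (j j' : Fin k) → χ<ᶠ (odd j) (even j') ≡ χ<ᶠ j j'
χ<ᶠ-odd-even j j' rewrite toℕ-odd j | toℕ-even j' = χ<-suc-double (toℕ j) (toℕ j')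
χ<ᶠ-odd-odd : ∀ {k} (j j' : Fin k) → χ<ᶠ (odd j) (odd j') ≡ χ<ᶠ j j'
χ<ᶠ-odd-odd j j' rewrite toℕ-odd j | toℕ-odd j' = χ<-suc-double-suc (toℕ j) (toℕ j')

crossBlocks : ∀ {k} (H : Fin (k * 2) → Fin (k * 2) → ℕ) → Fin k → Fin k → ℕ
crossBlocks H j j' = (H (even j) (even j') + H (even j) (odd j')) + (H (odd j) (even j') + H (odd j) (odd j'))

∑<-blocks : ∀ {k} (H : Fin (k * 2) → Fin (k * 2) → ℕ) →
  ∑ (λ p → ∑ (λ q → χ<ᶠ p q * H p q)) ≡
  ∑ (λ j → ∑ (λ j' → χ<ᶠ j j' * crossBlocks H j j')) + ∑ (λ j → H (even j) (odd j))
∑<-blocks {k} H = begin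
    ∑ (λ p → ∑ (λ q → χ<ᶠ p q * H p q))
      ≡⟨ ∑-cong (λ p → ∑-even-odd {k} (λ q → χ<ᶠ p q * H p q)) ⟩
    ∑ (λ p → ∑ (λ j' → χ<ᶠ p (even j') * H p (even j') + χ<ᶠ p (odd j') * H p (odd j')))
      ≡⟨ ∑-even-odd {k} _ ⟩
    ∑ (λ j → ∑ (λ j' → χ<ᶠ (even j) (even j') * H (even j) (even j') + χ<ᶠ (even j) (odd j') * H (even j) (odd j'))
           + ∑ (λ j' → χ<ᶠ (odd j) (even j') * H (odd j) (even j') + χ<ᶠ (odd j) (odd j') * H (odd j) (odd j')))
      ≡⟨ ∑-cong (λ j → trans (sym (∑-distrib-+ _ _)) (∑-cong (λ j' → entries j j'))) ⟩
    ∑ (λ j → ∑ (λ j' → χ<ᶠ j j' * crossBlocks H j j' + δ j j' * H (even j) (odd j')))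
      ≡⟨ ∑-cong (λ j → trans (∑-distrib-+ _ _)
                            (cong (∑ (λ j' → χ<ᶠ j j' * crossBlocks H j j') +_) (∑-δ j (λ j' → H (even j) (odd j'))))) ⟩
    ∑ (λ j → ∑ (λ j' → χ<ᶠ j j' * crossBlocks H j j') + H (even j) (odd j))
      ≡⟨ ∑-distrib-+ _ _ ⟩
    ∑ (λ j → ∑ (λ j' → χ<ᶠ j j' * crossBlocks H j j')) + ∑ (λ j → H (even j) (odd j)) ∎
  where
  open ≡-Reasoning
  collect : ∀ l d a b c e → (l * a + (l + d) * b) + (l * c + l * e) ≡ l * ((a + b) + (c + e)) + d * b
  collect = solve 6 (λ l d a b c e → (l :* a :+ (l :+ d) :* b) :+ (l :* c :+ l :* e) := l :* ((a :+ b) :+ (c :+ e)) :+ d :* b) refl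
  entries : ∀ j j' → (χ<ᶠ (even j) (even j') * H (even j) (even j') + χ<ᶠ (even j) (odd j') * H (even j) (odd j'))
              + (χ<ᶠ (odd j) (even j') * H (odd j) (even j') + χ<ᶠ (odd j) (odd j') * H (odd j) (odd j'))
              ≡ χ<ᶠ j j' * crossBlocks H j j' + δ j j' * H (even j) (odd j')
  entries j j' rewrite χ<ᶠ-even-even j j' | χ<ᶠ-even-odd j j' | χ<ᶠ-odd-even j j' | χ<ᶠ-odd-odd j j' =
    collect (χ<ᶠ j j') (δ j j') (H (even j) (even j')) (H (even j) (odd j')) (H (odd j) (even j')) (H (odd j) (odd j'))

double-injective : ∀ a b → a + a ≡ b + b → a ≡ b
double-injective zero zero e = refl
double-injective zero (suc b) ()
double-injective (suc a) zero ()
double-injective (suc a) (suc b) e rewrite +-suc a a | +-suc b b =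
  cong suc (double-injective a b (suc-injective (suc-injective e)))

double≢suc-double : ∀ a b → a + a ≢ suc (b + b)
double≢suc-double zero b ()
double≢suc-double (suc a) zero e rewrite +-suc a a = 1+n≢0 (suc-injective e)
double≢suc-double (suc a) (suc b) e rewrite +-suc a a | +-suc b b =
  double≢suc-double a b (suc-injective (suc-injective e))

even-injective : ∀ {k} {j j' : Fin k} → even j ≡ even j' → j ≡ j'
even-injective {j = j} {j'} e =
  FP.toℕ-injective (double-injective (toℕ j) (toℕ j') (trans (sym (toℕ-even j)) (trans (cong toℕ e) (toℕ-even j'))))

odd-injective : ∀ {k} {j j' : Fin k} → odd j ≡ odd j' → j ≡ j'
odd-injective {j = j} {j'} e =
  FP.toℕ-injective (double-injective (toℕ j) (toℕ j') (suc-injective (trans (sym (toℕ-odd j)) (trans (cong toℕ e) (toℕ-odd j')))))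

even<odd : ∀ {k} (j : Fin k) → toℕ (even j) < toℕ (odd j)
even<odd j rewrite toℕ-even j | toℕ-odd j = n<1+n _

odd≡suc-even : ∀ {k} (j : Fin k) → toℕ (odd j) ≡ suc (toℕ (even j))
odd≡suc-even j = trans (toℕ-odd j) (cong suc (sym (toℕ-even j)))

odd<even : ∀ {k} (j j' : Fin k) → j F.< j' → toℕ (odd j) < toℕ (even j')
odd<even j j' p rewrite toℕ-odd j | toℕ-even j' = subst (_≤ toℕ j' + toℕ j') (cong suc (+-suc (toℕ j) (toℕ j))) (+-mono-≤ p p)

even<odd′ : ∀ {k} (j j' : Fin k) → j F.< j' → toℕ (even j) < toℕ (odd j')
even<odd′ j j' p rewrite toℕ-even j | toℕ-odd j' = s≤s (+-mono-≤ (<⇒≤ p) (<⇒≤ p))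

even≢odd : ∀ {k} {j j' : Fin k} → even j ≢ odd j'
even≢odd {j = j} {j'} e = double≢suc-double (toℕ j) (toℕ j') (trans (sym (toℕ-even j)) (trans (cong toℕ e) (toℕ-odd j')))

-- Order patterns of four distinct values

a₁ b₁ a₂ b₂ : Fin 4
a₁ = zero
b₁ = suc zero
a₂ = suc (suc zero)
b₂ = suc (suc (suc zero))

tuple4 : ∀ {A : Set} → A → A → A → A → Fin 4 → A
tuple4 a b c d zero = a
tuple4 a b c d (suc zero) = b
tuple4 a b c d (suc (suc zero)) = c
tuple4 a b c d (suc (suc (suc zero))) = d

infixl 6 _⊕_
infixl 7 _⊗_
infix 8 _≺_

data OrderExpr : Set where
  _≺_ : Fin 4 → Fin 4 → OrderExpr
  _⊕_ _⊗_ : OrderExpr → OrderExpr → OrderExpr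

⟦_⟧ : OrderExpr → (Fin 4 → ℕ) → ℕ
⟦ i ≺ j ⟧ x = χ< (x i) (x j)
⟦ e ⊕ e′ ⟧ x = ⟦ e ⟧ x + ⟦ e′ ⟧ x
⟦ e ⊗ e′ ⟧ x = ⟦ e ⟧ x * ⟦ e′ ⟧ x

SameOrder : (Fin 4 → ℕ) → (Fin 4 → ℕ) → Set
SameOrder x y = ∀ i j → χ< (x i) (x j) ≡ χ< (y i) (y j)

⟦⟧-cong : ∀ e {x y} → SameOrder x y → ⟦ e ⟧ x ≡ ⟦ e ⟧ y
⟦⟧-cong (i ≺ j) h = h i j
⟦⟧-cong (e ⊕ e′) h = cong₂ _+_ (⟦⟧-cong e h) (⟦⟧-cong e′ h)
⟦⟧-cong (e ⊗ e′) h = cong₂ _*_ (⟦⟧-cong e h) (⟦⟧-cong e′ h)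

module Rank (x : Fin 4 → ℕ) (x-injective : Injective _≡_ _≡_ x) where
  rank : Fin 4 → ℕ
  rank i = ∑ (λ l → χ< (x l) (x i))

  rank<4 : ∀ i → rank i < 4
  rank<4 i =
    subst (_≤ 4) (trans (∑-distrib-+ _ (δ i)) (trans (cong (rank i +_) (∑δ≡1 i)) (+-comm (rank i) 1)))
      (≤-trans (∑-mono-≤ counted-once) (≤-reflexive (∑-ones {4})))
    where
    counted-once : ∀ l → χ< (x l) (x i) + δ i l ≤ 1
    counted-once l with i FP.≟ l
    ... | yes refl rewrite δ-self i | χ<-irrefl (x i) = ≤-refl
    ... | no ne rewrite δ-≢ ne = subst (_≤ 1) (sym (+-identityʳ _)) (χ<≤1 (x l) (x i))

  rank-mono-< : ∀ i j → x i < x j → rank i < rank j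
  rank-mono-< i j p = ∑-mono-< i below-j (subst₂ _<_ (sym (χ<-irrefl (x i))) (sym (χ<≡1 p)) (s≤s z≤n))
    where
    below-j : ∀ l → χ< (x l) (x i) ≤ χ< (x l) (x j)
    below-j l with χ<-cases (x l) (x i)
    ... | inj₁ (q , e) rewrite e | χ<≡1 (<-trans q p) = ≤-refl
    ... | inj₂ (q , e) rewrite e = z≤n

  χ<-rank : ∀ i j → χ< (x i) (x j) ≡ χ< (rank i) (rank j)
  χ<-rank i j with <-cmp (x i) (x j)
  ... | tri< a _ _ = trans (χ<≡1 a) (sym (χ<≡1 (rank-mono-< i j a)))
  ... | tri> _ _ c = trans (χ<≡0 (<⇒≤ c)) (sym (χ<≡0 (<⇒≤ (rank-mono-< j i c))))
  ... | tri≈ _ b _ rewrite x-injective b = trans (χ<-irrefl (x j)) (sym (χ<-irrefl (rank j)))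

  rankᶠ : Fin 4 → Fin 4
  rankᶠ i = fromℕ< (rank<4 i)

  rankTuple : Fin 4 → ℕ
  rankTuple = tuple4 (toℕ (rankᶠ a₁)) (toℕ (rankᶠ b₁)) (toℕ (rankᶠ a₂)) (toℕ (rankᶠ b₂))

  SameOrder-rankTuple : SameOrder x rankTuple
  SameOrder-rankTuple i j = trans (χ<-rank i j) (cong₂ χ< (sym (toℕ-rankᶠ i)) (sym (toℕ-rankᶠ j)))
    where
    toℕ-rankᶠ : ∀ i → rankTuple i ≡ rank i
    toℕ-rankᶠ zero = FP.toℕ-fromℕ< (rank<4 a₁)
    toℕ-rankᶠ (suc zero) = FP.toℕ-fromℕ< (rank<4 b₁)
    toℕ-rankᶠ (suc (suc zero)) = FP.toℕ-fromℕ< (rank<4 a₂)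
    toℕ-rankᶠ (suc (suc (suc zero))) = FP.toℕ-fromℕ< (rank<4 b₂)

∧-elimˡ : ∀ {a b} → a ∧ b ≡ true → a ≡ true
∧-elimˡ {true} _ = refl

∧-elimʳ : ∀ {a b} → a ∧ b ≡ true → b ≡ true
∧-elimʳ {true} e = e

not∨-elim : ∀ {a b} → not a ∨ b ≡ true → a ≡ true → b ≡ true
not∨-elim {true} e refl = e

allFin4 : (Fin 4 → Bool) → Bool
allFin4 P = P a₁ ∧ (P b₁ ∧ (P a₂ ∧ P b₂))

allFin4-sound : ∀ P → allFin4 P ≡ true → ∀ i → P i ≡ true
allFin4-sound P e zero = ∧-elimˡ {P a₁} e
allFin4-sound P e (suc zero) = ∧-elimˡ {P b₁} (∧-elimʳ {P a₁} e)
allFin4-sound P e (suc (suc zero)) = ∧-elimˡ {P a₂} (∧-elimʳ {P b₁} (∧-elimʳ {P a₁} e))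
allFin4-sound P e (suc (suc (suc zero))) = ∧-elimʳ {P a₂} (∧-elimʳ {P b₁} (∧-elimʳ {P a₁} e))

allFin4⁴ : (Fin 4 → Fin 4 → Fin 4 → Fin 4 → Bool) → Bool
allFin4⁴ P = allFin4 (λ a → allFin4 (λ b → allFin4 (λ c → allFin4 (λ d → P a b c d))))

allFin4⁴-sound : ∀ P → allFin4⁴ P ≡ true → ∀ a b c d → P a b c d ≡ true
allFin4⁴-sound P e a b c d =
  allFin4-sound (λ d → P a b c d) (allFin4-sound (λ c → allFin4 (λ d → P a b c d))
    (allFin4-sound (λ b → allFin4 (λ c → allFin4 (λ d → P a b c d)))
      (allFin4-sound (λ a → allFin4 (λ b → allFin4 (λ c → allFin4 (λ d → P a b c d)))) e a) b) c) d

data Claim : Set where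
  _≤ᵉ_ _≡ᵉ_ : OrderExpr → OrderExpr → Claim

Holds : Claim → (Fin 4 → ℕ) → Set
Holds (e ≤ᵉ e′) x = ⟦ e ⟧ x ≤ ⟦ e′ ⟧ x
Holds (e ≡ᵉ e′) x = ⟦ e ⟧ x ≡ ⟦ e′ ⟧ x

holds? : Claim → (Fin 4 → ℕ) → Bool
holds? (e ≤ᵉ e′) x = ⟦ e ⟧ x ≤ᵇ ⟦ e′ ⟧ x
holds? (e ≡ᵉ e′) x = ⟦ e ⟧ x ≡ᵇ ⟦ e′ ⟧ x

holds?-sound : ∀ c x → holds? c x ≡ true → Holds c x
holds?-sound (e ≤ᵉ e′) x eq = ≤ᵇ⇒≤ _ _ (subst T (sym eq) tt)
holds?-sound (e ≡ᵉ e′) x eq = ≡ᵇ⇒≡ _ _ (subst T (sym eq) tt)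

Holds-transfer : ∀ c {x y} → SameOrder x y → Holds c y → Holds c x
Holds-transfer (e ≤ᵉ e′) h p = subst₂ _≤_ (sym (⟦⟧-cong e h)) (sym (⟦⟧-cong e′ h)) p
Holds-transfer (e ≡ᵉ e′) h p = trans (⟦⟧-cong e h) (trans p (sym (⟦⟧-cong e′ h)))

Assumptions : Set
Assumptions = List (OrderExpr × ℕ)

Assumed : Assumptions → (Fin 4 → ℕ) → Set
Assumed [] x = ⊤
Assumed ((e , n) ∷ as) x = ⟦ e ⟧ x ≡ n × Assumed as x

assumed? : Assumptions → (Fin 4 → ℕ) → Bool
assumed? [] x = true
assumed? ((e , n) ∷ as) x = (⟦ e ⟧ x ≡ᵇ n) ∧ assumed? as x

assumed?-complete : ∀ as {x y} → SameOrder x y → Assumed as x → assumed? as y ≡ true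
assumed?-complete [] h p = refl
assumed?-complete ((e , n) ∷ as) {x} {y} h (p , ps)
  rewrite T⇒≡true (≡⇒≡ᵇ (⟦ e ⟧ y) n (trans (sym (⟦⟧-cong e h)) p)) = assumed?-complete as h ps

apart : Fin 4 → Fin 4 → OrderExpr
apart i j = i ≺ j ⊕ j ≺ i

allDistinct : OrderExpr
allDistinct = (apart a₁ b₁ ⊗ apart a₁ a₂) ⊗ (apart a₁ b₂ ⊗ apart b₁ a₂) ⊗ (apart b₁ b₂ ⊗ apart a₂ b₂)

allDistinct-injective : ∀ (x : Fin 4 → ℕ) → Injective _≡_ _≡_ x → ⟦ allDistinct ⟧ x ≡ 1
allDistinct-injective x inj
  rewrite χ<-connex {x a₁} {x b₁} (FP.0≢1+n ∘ inj)
        | χ<-connex {x a₁} {x a₂} (FP.0≢1+n ∘ inj)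
        | χ<-connex {x a₁} {x b₂} (FP.0≢1+n ∘ inj)
        | χ<-connex {x b₁} {x a₂} (FP.0≢1+n ∘ FP.suc-injective ∘ inj)
        | χ<-connex {x b₁} {x b₂} (FP.0≢1+n ∘ FP.suc-injective ∘ inj)
        | χ<-connex {x a₂} {x b₂} (FP.0≢1+n ∘ FP.suc-injective ∘ FP.suc-injective ∘ inj) = refl

check : Assumptions → Claim → Fin 4 → Fin 4 → Fin 4 → Fin 4 → Bool
check as c a b c′ d = not (assumed? ((allDistinct , 1) ∷ as) y) ∨ holds? c y
  where y = tuple4 (toℕ a) (toℕ b) (toℕ c′) (toℕ d)

-- Only the relative order of four distinct values matters, and it is realised by their ranks in Fin 4.
check-sound : ∀ as c → allFin4⁴ (check as c) ≡ true →
  ∀ (x : Fin 4 → ℕ) → Injective _≡_ _≡_ x → Assumed as x → Holds c x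
check-sound as c checked x inj assumed = Holds-transfer c SameOrder-rankTuple (holds?-sound c _ holdsOnRanks)
  where
  open Rank x inj
  holdsOnRanks : holds? c rankTuple ≡ true
  holdsOnRanks = not∨-elim (allFin4⁴-sound (check as c) checked (rankᶠ a₁) (rankᶠ b₁) (rankᶠ a₂) (rankᶠ b₂))
    (assumed?-complete ((allDistinct , 1) ∷ as) SameOrder-rankTuple (allDistinct-injective x inj , assumed))

-- For blocks j < j′ of a conjugator u (π ∘ u = u ∘ α′), read a₁ b₁ a₂ b₂ as u (2j), u (2j+1), u (2j′), u (2j′+1):
-- the expressions below are the contributions of this pair of blocks to ℓ u, ℓ π and L′ π.
inversionsᵤ : OrderExpr
inversionsᵤ = (a₂ ≺ a₁ ⊕ b₂ ≺ a₁) ⊕ (a₂ ≺ b₁ ⊕ b₂ ≺ b₁)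

inversionsπ : OrderExpr
inversionsπ = (across a₁ b₁ a₂ b₂ ⊕ across a₁ b₁ b₂ a₂) ⊕ (across b₁ a₁ a₂ b₂ ⊕ across b₁ a₁ b₂ a₂)
  where
  inverted : Fin 4 → Fin 4 → Fin 4 → Fin 4 → OrderExpr
  inverted p p′ q q′ = p ≺ q ⊗ q′ ≺ p′
  across : Fin 4 → Fin 4 → Fin 4 → Fin 4 → OrderExpr
  across p p′ q q′ = inverted p p′ q q′ ⊕ inverted q q′ p p′

inversionsL′ : OrderExpr
inversionsL′ = (across a₁ b₁ a₂ b₂ ⊕ across a₁ b₁ b₂ a₂) ⊕ (across b₁ a₁ a₂ b₂ ⊕ across b₁ a₁ b₂ a₂)
  where
  inverted : Fin 4 → Fin 4 → Fin 4 → Fin 4 → OrderExpr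
  inverted p p′ q q′ = p ≺ q ⊗ (p ≺ p′ ⊗ (q ≺ q′ ⊗ ((q ≺ p ⊕ q′ ≺ p) ⊕ (q ≺ p′ ⊕ q′ ≺ p′))))
  across : Fin 4 → Fin 4 → Fin 4 → Fin 4 → OrderExpr
  across p p′ q q′ = inverted p p′ q q′ ⊕ inverted q q′ p p′

dominated : OrderExpr
dominated = a₂ ≺ a₁ ⊗ b₂ ≺ b₁

zeroᵉ : OrderExpr
zeroᵉ = a₁ ≺ a₁

increasingBlocks : Assumptions
increasingBlocks = (a₁ ≺ b₁ , 1) ∷ (a₂ ≺ b₂ , 1) ∷ []

inversionsL′≤inversionsᵤ : allFin4⁴ (check [] (inversionsL′ ≤ᵉ inversionsᵤ)) ≡ true
inversionsL′≤inversionsᵤ = refl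

inversionsL′+dominated≤inversionsᵤ : allFin4⁴ (check increasingBlocks ((inversionsL′ ⊕ dominated) ≤ᵉ inversionsᵤ)) ≡ true
inversionsL′+dominated≤inversionsᵤ = refl

inversionsL′≡inversionsᵤ : allFin4⁴ (check ((dominated , 0) ∷ increasingBlocks) (inversionsL′ ≡ᵉ inversionsᵤ)) ≡ true
inversionsL′≡inversionsᵤ = refl

2inversionsᵤ≤inversionsπ : allFin4⁴ (check ((dominated , 0) ∷ increasingBlocks) ((inversionsᵤ ⊕ inversionsᵤ) ≤ᵉ inversionsπ)) ≡ true
2inversionsᵤ≤inversionsπ = refl

inversionsπ-consecutive : allFin4⁴ (check ((b₁ ≺ a₂ , 1) ∷ increasingBlocks) (inversionsπ ≡ᵉ zeroᵉ)) ≡ true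
inversionsπ-consecutive = refl

χ<ᶠ-cases : ∀ {n} (j j' : Fin n) → χ<ᶠ j j' ≡ 0 ⊎ (χ<ᶠ j j' ≡ 1 × j F.< j')
χ<ᶠ-cases j j' with χ<-cases (toℕ j) (toℕ j')
... | inj₁ (p , e) = inj₂ (e , p)
... | inj₂ (_ , e) = inj₁ e

cong₄ : ∀ (f : ℕ → ℕ → ℕ → ℕ → ℕ) {a a' b b' c c' d d'} → a ≡ a' → b ≡ b' → c ≡ c' → d ≡ d' → f a b c d ≡ f a' b' c' d'
cong₄ f refl refl refl refl = refl

crossInversionsπ : ℕ → ℕ → ℕ → ℕ → ℕ → ℕ → ℕ → ℕ → ℕ
crossInversionsπ a b c d a' b' c' d' =
  ((χ< a c * χ< c' a' + χ< c a * χ< a' c') + (χ< a d * χ< d' a' + χ< d a * χ< a' d'))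
  + ((χ< b c * χ< c' b' + χ< c b * χ< b' c') + (χ< b d * χ< d' b' + χ< d b * χ< b' d'))

invertedL′ : ℕ → ℕ → ℕ → ℕ → ℕ
invertedL′ a a' b b' = χ< a b * (χ< a a' * (χ< b b' * ((χ< b a + χ< b' a) + (χ< b a' + χ< b' a'))))

crossInversionsL′ : ℕ → ℕ → ℕ → ℕ → ℕ → ℕ → ℕ → ℕ → ℕ
crossInversionsL′ a b c d a' b' c' d' =
  ((invertedL′ a a' c c' + invertedL′ c c' a a') + (invertedL′ a a' d d' + invertedL′ d d' a a'))
  + ((invertedL′ b b' c c' + invertedL′ c c' b b') + (invertedL′ b b' d d' + invertedL′ d d' b b'))

withinBlock-inversionsπ≡1 : ∀ {a b} → a ≢ b → χ< a b * χ< a b + χ< b a * χ< b a ≡ 1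
withinBlock-inversionsπ≡1 {a} {b} ne with χ<-cases a b | χ<-cases b a
... | inj₁ (p , e) | inj₁ (q , e') = ⊥-elim (<-asym p q)
... | inj₁ (p , e) | inj₂ (q , e') rewrite e | e' = refl
... | inj₂ (p , e) | inj₁ (q , e') rewrite e | e' = refl
... | inj₂ (p , e) | inj₂ (q , e') = ⊥-elim (ne (≤-antisym q p))

withinBlock-invertedL′≡0 : ∀ a b → invertedL′ a b b a + invertedL′ b a a b ≡ 0
withinBlock-invertedL′≡0 a b with χ<-cases a b | χ<-cases b a
... | inj₁ (p , e) | inj₁ (q , e') = ⊥-elim (<-asym p q)
... | inj₁ (p , e) | inj₂ (q , e') rewrite e | e' = refl
... | inj₂ (p , e) | inj₁ (q , e') rewrite e | e' = refl
... | inj₂ (p , e) | inj₂ (q , e') rewrite e | e' = refl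

IsConjugator : ∀ k → (π u : Fin (k * 2) → Fin (k * 2)) → Set
IsConjugator k π u = ∀ p → π (u p) ≡ u (α′ k p)

module BlockSums (k : ℕ) (π u : Fin (k * 2) → Fin (k * 2)) (u-perm : IsPerm u) (conj : IsConjugator k π u) where
  u₀ u₁ : Fin k → ℕ
  u₀ j = toℕ (u (even j))
  u₁ j = toℕ (u (odd j))

  BlocksIncreasing : Set
  BlocksIncreasing = ∀ j → u₀ j < u₁ j

  NoDominatedBlock : Set
  NoDominatedBlock = ∀ j j' → j F.< j' → ¬ (u₀ j' < u₀ j × u₁ j' < u₁ j)

  values : Fin k → Fin k → Fin 4 → ℕ
  values j j' = tuple4 (u₀ j) (u₁ j) (u₀ j') (u₁ j')

  π-u-even : ∀ j → toℕ (π (u (even j))) ≡ u₁ j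
  π-u-even j = cong toℕ (trans (conj (even j)) (cong u (α′-even j)))

  π-u-odd : ∀ j → toℕ (π (u (odd j))) ≡ u₀ j
  π-u-odd j = cong toℕ (trans (conj (odd j)) (cong u (α′-odd j)))

  u₀≢u₁ : ∀ j → u₀ j ≢ u₁ j
  u₀≢u₁ j e = even≢odd (u-perm (FP.toℕ-injective e))

  values-injective : ∀ {j j'} → j ≢ j' → Injective _≡_ _≡_ (values j j')
  values-injective {j} {j'} ne {x} {y} e = distinct x y e
    where
    u-inj : ∀ {p q} → toℕ (u p) ≡ toℕ (u q) → p ≡ q
    u-inj e = u-perm (FP.toℕ-injective e)
    distinct : ∀ x y → values j j' x ≡ values j j' y → x ≡ y
    distinct zero zero e = refl
    distinct zero (suc zero) e = ⊥-elim (u₀≢u₁ _ e)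
    distinct zero (suc (suc zero)) e = ⊥-elim (ne (even-injective (u-inj e)))
    distinct zero (suc (suc (suc zero))) e = ⊥-elim (even≢odd (u-inj e))
    distinct (suc zero) zero e = ⊥-elim (u₀≢u₁ _ (sym e))
    distinct (suc zero) (suc zero) e = refl
    distinct (suc zero) (suc (suc zero)) e = ⊥-elim (even≢odd (sym (u-inj e)))
    distinct (suc zero) (suc (suc (suc zero))) e = ⊥-elim (ne (odd-injective (u-inj e)))
    distinct (suc (suc zero)) zero e = ⊥-elim (ne (sym (even-injective (u-inj e))))
    distinct (suc (suc zero)) (suc zero) e = ⊥-elim (even≢odd (u-inj e))
    distinct (suc (suc zero)) (suc (suc zero)) e = refl
    distinct (suc (suc zero)) (suc (suc (suc zero))) e = ⊥-elim (u₀≢u₁ _ e)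
    distinct (suc (suc (suc zero))) zero e = ⊥-elim (even≢odd (sym (u-inj e)))
    distinct (suc (suc (suc zero))) (suc zero) e = ⊥-elim (ne (sym (odd-injective (u-inj e))))
    distinct (suc (suc (suc zero))) (suc (suc zero)) e = ⊥-elim (u₀≢u₁ _ (sym e))
    distinct (suc (suc (suc zero))) (suc (suc (suc zero))) e = refl

  cross : OrderExpr → ℕ
  cross e = ∑ (λ j → ∑ (λ j' → χ<ᶠ j j' * ⟦ e ⟧ (values j j')))

  descents : ℕ
  descents = ∑ (λ j → χ< (u₁ j) (u₀ j))

  ∑∑-reindex : ∀ (F : Fin (k * 2) → Fin (k * 2) → ℕ) → ∑ (λ a → ∑ (λ b → F a b)) ≡ ∑ (λ p → ∑ (λ q → F (u p) (u q)))
  ∑∑-reindex F = trans (∑-permute u u-perm (λ a → ∑ (λ b → F a b))) (∑-cong (λ p → ∑-permute u u-perm (λ b → F (u p) b)))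

  ℓu≡cross : ℓ u ≡ cross inversionsᵤ + descents
  ℓu≡cross = trans (ℓ≡∑inversions u) (∑<-blocks (λ p q → χ< (toℕ (u q)) (toℕ (u p))))

  ℓπ≡cross : ℓ π ≡ cross inversionsπ + k
  ℓπ≡cross = begin
      ℓ π
        ≡⟨ ℓ≡∑inversions π ⟩
      ∑ (λ a → ∑ (λ b → χ<ᶠ a b * χ< (toℕ (π b)) (toℕ (π a))))
        ≡⟨ ∑∑-reindex (λ a b → χ<ᶠ a b * χ< (toℕ (π b)) (toℕ (π a))) ⟩
      ∑ (λ p → ∑ (λ q → I p q))
        ≡⟨ ∑∑-triangle I ⟩
      ∑ (λ p → ∑ (λ q → χ<ᶠ p q * (I p q + I q p))) + ∑ (λ p → I p p)
        ≡⟨ cong₂ _+_ (∑<-blocks (λ p q → I p q + I q p)) (∑-cong (λ p → χ<-irrefl-* (toℕ (u p)) _)) ⟩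
      (∑ (λ j → ∑ (λ j' → χ<ᶠ j j' * crossBlocks (λ p q → I p q + I q p) j j'))
        + ∑ (λ j → I (even j) (odd j) + I (odd j) (even j))) + ∑ (λ _ → 0)
        ≡⟨ cong₂ _+_ (cong₂ _+_ (∑-cong (λ j → ∑-cong (λ j' → cong (χ<ᶠ j j' *_) (across j j')))) (trans (∑-cong within) ∑-ones))
                     ∑-zeros ⟩
      (cross inversionsπ + k) + 0
        ≡⟨ +-identityʳ _ ⟩
      cross inversionsπ + k ∎
    where
    open ≡-Reasoning
    I : Fin (k * 2) → Fin (k * 2) → ℕ
    I p q = χ< (toℕ (u p)) (toℕ (u q)) * χ< (toℕ (π (u q))) (toℕ (π (u p)))
    across : ∀ j j' → crossBlocks (λ p q → I p q + I q p) j j' ≡ ⟦ inversionsπ ⟧ (values j j')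
    across j j' = cong₄ (crossInversionsπ (u₀ j) (u₁ j) (u₀ j') (u₁ j')) (π-u-even j) (π-u-odd j) (π-u-even j') (π-u-odd j')
    within : ∀ j → I (even j) (odd j) + I (odd j) (even j) ≡ 1
    within j = trans (cong₂ (λ a b → χ< (u₀ j) (u₁ j) * χ< a b + χ< (u₁ j) (u₀ j) * χ< b a) (π-u-odd j) (π-u-even j))
                     (withinBlock-inversionsπ≡1 (u₀≢u₁ j))

  L′≡cross : L′ π ≡ cross inversionsL′
  L′≡cross = begin
      L′ π
        ≡⟨ StandardWord.L′≡∑ π ⟩
      ∑ (λ a → χ< (toℕ a) (toℕ (π a)) * χ< (toℕ (π a)) (toℕ a))
        + ∑ (λ a → ∑ (λ a' → χ<ᶠ a a' * (χ< (toℕ a) (toℕ (π a)) * (χ< (toℕ a') (toℕ (π a')) * StandardWord.pairInversions π a a'))))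
        ≡⟨ cong₂ _+_ (trans (∑-cong (λ a → χ<-asym (toℕ a) (toℕ (π a)))) ∑-zeros)
                     (∑∑-reindex (λ a a' → χ<ᶠ a a' * (χ< (toℕ a) (toℕ (π a))
                                                         * (χ< (toℕ a') (toℕ (π a')) * StandardWord.pairInversions π a a')))) ⟩
      0 + ∑ (λ p → ∑ (λ q → I p q))
        ≡⟨ ∑∑-triangle I ⟩
      ∑ (λ p → ∑ (λ q → χ<ᶠ p q * (I p q + I q p))) + ∑ (λ p → I p p)
        ≡⟨ cong₂ _+_ (∑<-blocks (λ p q → I p q + I q p)) (∑-cong (λ p → χ<-irrefl-* (toℕ (u p)) _)) ⟩
      (∑ (λ j → ∑ (λ j' → χ<ᶠ j j' * crossBlocks (λ p q → I p q + I q p) j j'))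
        + ∑ (λ j → I (even j) (odd j) + I (odd j) (even j))) + ∑ (λ _ → 0)
        ≡⟨ cong₂ _+_ (cong₂ _+_ (∑-cong (λ j → ∑-cong (λ j' → cong (χ<ᶠ j j' *_) (across j j')))) (trans (∑-cong within) ∑-zeros))
                     ∑-zeros ⟩
      (cross inversionsL′ + 0) + 0
        ≡⟨ trans (+-identityʳ _) (+-identityʳ _) ⟩
      cross inversionsL′ ∎
    where
    open ≡-Reasoning
    I : Fin (k * 2) → Fin (k * 2) → ℕ
    I p q = invertedL′ (toℕ (u p)) (toℕ (π (u p))) (toℕ (u q)) (toℕ (π (u q)))
    across : ∀ j j' → crossBlocks (λ p q → I p q + I q p) j j' ≡ ⟦ inversionsL′ ⟧ (values j j')
    across j j' = cong₄ (crossInversionsL′ (u₀ j) (u₁ j) (u₀ j') (u₁ j')) (π-u-even j) (π-u-odd j) (π-u-even j') (π-u-odd j')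
    within : ∀ j → I (even j) (odd j) + I (odd j) (even j) ≡ 0
    within j = trans (cong₂ (λ a b → invertedL′ (u₀ j) a (u₁ j) b + invertedL′ (u₁ j) b (u₀ j) a) (π-u-even j) (π-u-odd j))
                     (withinBlock-invertedL′≡0 (u₀ j) (u₁ j))

  PairwiseBelow : OrderExpr → OrderExpr → Set
  PairwiseBelow e e′ = ∀ j j' → j F.< j' → ⟦ e ⟧ (values j j') ≤ ⟦ e′ ⟧ (values j j')

  cross-term-mono-≤ : ∀ e e′ → PairwiseBelow e e′ → ∀ j j' → χ<ᶠ j j' * ⟦ e ⟧ (values j j') ≤ χ<ᶠ j j' * ⟦ e′ ⟧ (values j j')
  cross-term-mono-≤ e e′ h j j' with χ<ᶠ-cases j j'
  ... | inj₁ eq rewrite eq = z≤n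
  ... | inj₂ (eq , j<j') rewrite eq = +-monoˡ-≤ 0 (h j j' j<j')

  cross-mono-≤ : ∀ e e′ → PairwiseBelow e e′ → cross e ≤ cross e′
  cross-mono-≤ e e′ h = ∑-mono-≤ (λ j → ∑-mono-≤ (cross-term-mono-≤ e e′ h j))

  cross-mono-≤-equality : ∀ e e′ → PairwiseBelow e e′ → cross e ≡ cross e′ →
    ∀ j j' → j F.< j' → ⟦ e ⟧ (values j j') ≡ ⟦ e′ ⟧ (values j j')
  cross-mono-≤-equality e e′ h eq j j' j<j' =
    *-cancelˡ-≡ _ _ 1 (subst (λ c → c * ⟦ e ⟧ (values j j') ≡ c * ⟦ e′ ⟧ (values j j')) (χ<≡1 j<j') termsEqual)
    where
    termsEqual : χ<ᶠ j j' * ⟦ e ⟧ (values j j') ≡ χ<ᶠ j j' * ⟦ e′ ⟧ (values j j')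
    termsEqual = ∑-mono-≤-equality (cross-term-mono-≤ e e′ h j) (∑-mono-≤-equality (λ j → ∑-mono-≤ (cross-term-mono-≤ e e′ h j)) eq j) j'

  checked : ∀ as c → allFin4⁴ (check as c) ≡ true → (∀ j j' → j F.< j' → Assumed as (values j j')) →
    ∀ j j' → j F.< j' → Holds c (values j j')
  checked as c chk assumed j j' j<j' = check-sound as c chk (values j j') (values-injective (FP.<⇒≢ j<j')) (assumed j j' j<j')

  increasing-assumed : BlocksIncreasing → ∀ j j' → Assumed increasingBlocks (values j j')
  increasing-assumed inc j j' = χ<≡1 (inc j) , χ<≡1 (inc j') , tt

  no-domination-assumed : BlocksIncreasing → NoDominatedBlock →
    ∀ j j' → j F.< j' → Assumed ((dominated , 0) ∷ increasingBlocks) (values j j')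
  no-domination-assumed inc nd j j' j<j' = notDominated , increasing-assumed inc j j'
    where
    notDominated : χ< (u₀ j') (u₀ j) * χ< (u₁ j') (u₁ j) ≡ 0
    notDominated with χ<-cases (u₀ j') (u₀ j) | χ<-cases (u₁ j') (u₁ j)
    ... | inj₂ (_ , e) | _ rewrite e = refl
    ... | inj₁ (_ , e) | inj₂ (_ , e') rewrite e | e' = refl
    ... | inj₁ (c , _) | inj₁ (c' , _) = ⊥-elim (nd j j' j<j' (c , c'))

  inversionsL′-below : PairwiseBelow inversionsL′ inversionsᵤ
  inversionsL′-below = checked [] (inversionsL′ ≤ᵉ inversionsᵤ) inversionsL′≤inversionsᵤ (λ _ _ _ → tt)

  crossL′≤crossᵤ : cross inversionsL′ ≤ cross inversionsᵤ
  crossL′≤crossᵤ = cross-mono-≤ inversionsL′ inversionsᵤ inversionsL′-below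

  L′≤ℓ : L′ π ≤ ℓ u
  L′≤ℓ = subst₂ _≤_ (sym L′≡cross) (sym ℓu≡cross) (≤-trans crossL′≤crossᵤ (m≤m+n (cross inversionsᵤ) descents))

  module _ (L′≡ℓ : L′ π ≡ ℓ u) where
    private
      tight : cross inversionsL′ ≡ cross inversionsᵤ × 0 ≡ descents
      tight = +-mono-≤-equality crossL′≤crossᵤ z≤n
                (trans (+-identityʳ (cross inversionsL′)) (trans (sym L′≡cross) (trans L′≡ℓ ℓu≡cross)))

    L′≡ℓ⇒BlocksIncreasing : BlocksIncreasing
    L′≡ℓ⇒BlocksIncreasing j with <-cmp (u₀ j) (u₁ j)
    ... | tri< lt _ _ = lt
    ... | tri≈ _ eq _ = ⊥-elim (u₀≢u₁ j eq)
    ... | tri> _ _ gt = ⊥-elim (0≢1+n (trans (∑-mono-≤-equality {f = λ _ → 0} (λ _ → z≤n) (trans ∑-zeros (proj₂ tight)) j) (χ<≡1 gt)))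

    L′≡ℓ⇒NoDominatedBlock : NoDominatedBlock
    L′≡ℓ⇒NoDominatedBlock j j' j<j' (c , c') = contradiction (+-cancelˡ-≤ (⟦ inversionsL′ ⟧ (values j j')) 1 0 bound) λ ()
      where
      bound : ⟦ inversionsL′ ⟧ (values j j') + 1 ≤ ⟦ inversionsL′ ⟧ (values j j') + 0
      bound = subst₂ _≤_ (cong (⟦ inversionsL′ ⟧ (values j j') +_) (cong₂ _*_ (χ<≡1 c) (χ<≡1 c')))
                (trans (sym (cross-mono-≤-equality inversionsL′ inversionsᵤ inversionsL′-below (proj₁ tight) j j' j<j'))
                       (sym (+-identityʳ (⟦ inversionsL′ ⟧ (values j j')))))
                (checked increasingBlocks ((inversionsL′ ⊕ dominated) ≤ᵉ inversionsᵤ) inversionsL′+dominated≤inversionsᵤ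
                  (λ j j' _ → increasing-assumed L′≡ℓ⇒BlocksIncreasing j j') j j' j<j')

  module _ (inc : BlocksIncreasing) (nd : NoDominatedBlock) where
    private
      noDescents : descents ≡ 0
      noDescents = trans (∑-cong (λ j → χ<≡0 (<⇒≤ (inc j)))) ∑-zeros

      ℓu≡crossᵤ : ℓ u ≡ cross inversionsᵤ
      ℓu≡crossᵤ = trans ℓu≡cross (trans (cong (cross inversionsᵤ +_) noDescents) (+-identityʳ (cross inversionsᵤ)))

    ℓ≡L′ : ℓ u ≡ L′ π
    ℓ≡L′ = trans ℓu≡crossᵤ (trans (≤-antisym crossᵤ≤crossL′ crossL′≤crossᵤ) (sym L′≡cross))
      where
      crossᵤ≤crossL′ : cross inversionsᵤ ≤ cross inversionsL′
      crossᵤ≤crossL′ = cross-mono-≤ inversionsᵤ inversionsL′ (λ j j' j<j' →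
        ≤-reflexive (sym (checked ((dominated , 0) ∷ increasingBlocks) (inversionsL′ ≡ᵉ inversionsᵤ) inversionsL′≡inversionsᵤ
                                  (no-domination-assumed inc nd) j j' j<j')))

    2ℓ+k≤ℓπ : ℓ u + ℓ u + k ≤ ℓ π
    2ℓ+k≤ℓπ = subst₂ _≤_ (cong (λ z → z + z + k) (sym ℓu≡crossᵤ)) (sym ℓπ≡cross)
      (+-monoˡ-≤ k (subst (_≤ cross inversionsπ) doubled
        (cross-mono-≤ (inversionsᵤ ⊕ inversionsᵤ) inversionsπ
          (checked ((dominated , 0) ∷ increasingBlocks) ((inversionsᵤ ⊕ inversionsᵤ) ≤ᵉ inversionsπ) 2inversionsᵤ≤inversionsπ
                   (no-domination-assumed inc nd)))))
      where
      doubled : cross (inversionsᵤ ⊕ inversionsᵤ) ≡ cross inversionsᵤ + cross inversionsᵤ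
      doubled = trans (∑-cong (λ j → trans (∑-cong (λ j' → *-distribˡ-+ (χ<ᶠ j j') _ _)) (∑-distrib-+ _ _))) (∑-distrib-+ _ _)

ℓ-α′≤k : ∀ k → ℓ (α′ k) ≤ k
ℓ-α′≤k k = subst (_≤ k) (sym ℓπ≡cross) (≤-reflexive (cong (_+ k) crossπ≡0))
  where
  open BlockSums k (α′ k) id (λ e → e) (λ p → refl)
  crossπ≡0 : cross inversionsπ ≡ 0
  crossπ≡0 = n≤0⇒n≡0 (≤-trans (cross-mono-≤ inversionsπ zeroᵉ consecutive) (≤-reflexive crossZero))
    where
    consecutive : PairwiseBelow inversionsπ zeroᵉ
    consecutive j j' j<j' = ≤-reflexive (checked ((b₁ ≺ a₂ , 1) ∷ increasingBlocks) (inversionsπ ≡ᵉ zeroᵉ) inversionsπ-consecutive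
      (λ j j' j<j' → χ<≡1 (odd<even j j' j<j') , increasing-assumed even<odd j j') j j' j<j')
    crossZero : cross zeroᵉ ≡ 0
    crossZero = trans (∑-cong (λ j → trans (∑-cong (λ j' → *-χ<-irrefl (χ<ᶠ j j') (u₀ j))) ∑-zeros)) ∑-zeros

-- Simple reflections

swapℕ : ℕ → ℕ → ℕ
swapℕ a x with x ℕ.≟ a
... | yes _ = suc a
... | no _ with x ℕ.≟ suc a
...   | yes _ = a
...   | no _ = x

data SwapCase (a x : ℕ) : Set where
  left : x ≡ a → SwapCase a x
  right : x ≡ suc a → SwapCase a x
  other : x ≢ a → x ≢ suc a → SwapCase a x

swapCase : ∀ a x → SwapCase a x
swapCase a x with x ℕ.≟ a
... | yes e = left e
... | no n1 with x ℕ.≟ suc a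
...   | yes e = right e
...   | no n2 = other n1 n2

swapℕ-left : ∀ a → swapℕ a a ≡ suc a
swapℕ-left a with a ℕ.≟ a
... | yes _ = refl
... | no ne = ⊥-elim (ne refl)

swapℕ-right : ∀ a → swapℕ a (suc a) ≡ a
swapℕ-right a with suc a ℕ.≟ a
... | yes e = ⊥-elim (1+n≢n e)
... | no _ with suc a ℕ.≟ suc a
...   | yes _ = refl
...   | no ne = ⊥-elim (ne refl)

swapℕ-other : ∀ {a x} → x ≢ a → x ≢ suc a → swapℕ a x ≡ x
swapℕ-other {a} {x} n1 n2 with x ℕ.≟ a
... | yes e = ⊥-elim (n1 e)
... | no _ with x ℕ.≟ suc a
...   | yes e = ⊥-elim (n2 e)
...   | no _ = refl

swapℕ-involutive : ∀ a x → swapℕ a (swapℕ a x) ≡ x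
swapℕ-involutive a x with swapCase a x
... | left refl rewrite swapℕ-left a = swapℕ-right a
... | right refl rewrite swapℕ-right a = swapℕ-left a
... | other n1 n2 rewrite swapℕ-other n1 n2 = swapℕ-other n1 n2

χ<-sucˡ : ∀ {a y} → y ≢ a → y ≢ suc a → χ< (suc a) y ≡ χ< a y
χ<-sucˡ {a} {y} n1 n2 with χ<-cases a y
... | inj₁ (p , e) rewrite e = χ<≡1 (≤∧≢⇒< p (n2 ∘ sym))
... | inj₂ (p , e) rewrite e = χ<≡0 (≤-trans p (n≤1+n a))

χ<-sucʳ : ∀ {a x} → x ≢ a → x ≢ suc a → χ< x (suc a) ≡ χ< x a
χ<-sucʳ {a} {x} n1 n2 with χ<-cases x a
... | inj₁ (p , e) rewrite e = χ<≡1 (≤-trans p (n≤1+n a))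
... | inj₂ (p , e) rewrite e = χ<≡0 (≤∧≢⇒< p (n1 ∘ sym))

n≢1+n : ∀ n → n ≢ suc n
n≢1+n n e = 1+n≢n (sym e)

-- Swapping a and a+1 changes a comparison exactly on the pair (a , a+1) itself.
χ<-swapℕ : ∀ a x y → χ< (swapℕ a x) (swapℕ a y) + χ≡ x a * χ≡ y (suc a) ≡ χ< x y + χ≡ x (suc a) * χ≡ y a
χ<-swapℕ a x y with swapCase a x | swapCase a y
... | left refl | left refl
  rewrite swapℕ-left a | χ≡-refl a | χ≡-≢ (n≢1+n a) | χ<-irrefl (suc a) = refl
... | left refl | right refl
  rewrite swapℕ-left a | swapℕ-right a | χ≡-refl a | χ≡-≢ (n≢1+n a)
        | χ<≡0 {suc a} {a} (n≤1+n a) | χ<≡1 {a} {suc a} ≤-refl = refl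
... | left refl | other m1 m2
  rewrite swapℕ-left a | swapℕ-other m1 m2 | χ≡-refl a | χ≡-≢ (n≢1+n a) | χ≡-≢ m2 | χ<-sucˡ m1 m2 = refl
... | right refl | left refl
  rewrite swapℕ-left a | swapℕ-right a | χ≡-refl a | χ≡-≢ (n≢1+n a) | χ≡-≢ (n≢1+n a ∘ sym)
        | χ<≡0 {suc a} {a} (n≤1+n a) | χ<≡1 {a} {suc a} ≤-refl = refl
... | right refl | right refl
  rewrite swapℕ-right a | χ≡-refl (suc a) | χ≡-≢ (n≢1+n a ∘ sym) | χ<-irrefl (suc a) = refl
... | right refl | other m1 m2
  rewrite swapℕ-right a | swapℕ-other m1 m2 | χ≡-refl (suc a) | χ≡-≢ (n≢1+n a ∘ sym) | χ≡-≢ m1 | χ<-sucˡ m1 m2 = refl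
... | other n1 n2 | left refl
  rewrite swapℕ-left a | swapℕ-other n1 n2 | χ≡-≢ n1 | χ≡-≢ n2 | χ<-sucʳ n1 n2 = refl
... | other n1 n2 | right refl
  rewrite swapℕ-right a | swapℕ-other n1 n2 | χ≡-≢ n1 | χ≡-≢ n2 | χ<-sucʳ n1 n2 = refl
... | other n1 n2 | other m1 m2
  rewrite swapℕ-other n1 n2 | swapℕ-other m1 m2 | χ≡-≢ n1 | χ≡-≢ n2 = refl

module SimpleReflection {n} (i j : Fin n) (adj : toℕ j ≡ suc (toℕ i)) where
  t : Fin n → Fin n
  t = transpose i j

  toℕ-t : ∀ x → toℕ (t x) ≡ swapℕ (toℕ i) (toℕ x)
  toℕ-t x with x FP.≟ i
  ... | yes refl = trans adj (sym (swapℕ-left (toℕ i)))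
  ... | no n1 with x FP.≟ j
  ...   | yes refl = trans (sym (swapℕ-right (toℕ i))) (cong (swapℕ (toℕ i)) (sym adj))
  ...   | no n2 = sym (swapℕ-other (n1 ∘ FP.toℕ-injective) (λ e → n2 (FP.toℕ-injective (trans e (sym adj)))))

  t-involutive : ∀ x → t (t x) ≡ x
  t-involutive x =
    FP.toℕ-injective (trans (toℕ-t (t x)) (trans (cong (swapℕ (toℕ i)) (toℕ-t x)) (swapℕ-involutive (toℕ i) (toℕ x))))

  t-perm : IsPerm t
  t-perm {x} {y} e = trans (sym (t-involutive x)) (trans (cong t e) (t-involutive y))

  module LeftMultiplication (u : Fin n → Fin n) (u-perm : IsPerm u) where
    posᵢ posⱼ : Fin n
    posᵢ = inverse u u-perm i
    posⱼ = inverse u u-perm j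

    χ≡-value : ∀ y p → χ≡ (toℕ (u p)) (toℕ y) ≡ δ (inverse u u-perm y) p
    χ≡-value y p with p FP.≟ inverse u u-perm y
    ... | yes refl rewrite inverseʳ u u-perm y = trans (χ≡-refl (toℕ y)) (sym (χ≡-refl (toℕ (inverse u u-perm y))))
    ... | no ne = trans (χ≡-≢ (λ e → ne (trans (sym (inverseˡ u u-perm p)) (cong (inverse u u-perm) (FP.toℕ-injective e)))))
                        (sym (χ≡-≢ (λ e → ne (sym (FP.toℕ-injective e)))))

    ∑∑-δ : ∀ (A B : Fin n) → ∑ (λ p → ∑ (λ q → χ<ᶠ p q * (δ A q * δ B p))) ≡ χ<ᶠ B A
    ∑∑-δ A B = trans (∑-cong (λ p → trans (∑-cong (λ q → rotate (χ<ᶠ p q) (δ A q) (δ B p))) (∑-δ A (λ q → δ B p * χ<ᶠ p q))))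
                     (∑-δ B (λ p → χ<ᶠ p A))
      where
      rotate : ∀ x y z → x * (y * z) ≡ y * (z * x)
      rotate = solve 3 (λ x y z → x :* (y :* z) := y :* (z :* x)) refl

    ℓ-t∘-exchange : ℓ (t ∘ u) + χ<ᶠ posⱼ posᵢ ≡ ℓ u + χ<ᶠ posᵢ posⱼ
    ℓ-t∘-exchange = begin
        ℓ (t ∘ u) + χ<ᶠ posⱼ posᵢ
          ≡⟨ cong₂ _+_ (trans (ℓ≡∑inversions (t ∘ u))
                              (∑-cong (λ p → ∑-cong (λ q → cong₂ (λ x y → χ<ᶠ p q * χ< x y) (toℕ-t (u q)) (toℕ-t (u p))))))
                       (sym (∑∑-δ posᵢ posⱼ)) ⟩
        ∑ (λ p → ∑ (λ q → χ<ᶠ p q * χ< (swapℕ a (g q)) (swapℕ a (g p)))) + ∑ (λ p → ∑ (λ q → χ<ᶠ p q * (δ posᵢ q * δ posⱼ p)))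
          ≡⟨ sym (trans (∑-cong (λ p → ∑-distrib-+ _ _)) (∑-distrib-+ _ _)) ⟩
        ∑ (λ p → ∑ (λ q → χ<ᶠ p q * χ< (swapℕ a (g q)) (swapℕ a (g p)) + χ<ᶠ p q * (δ posᵢ q * δ posⱼ p)))
          ≡⟨ ∑-cong (λ p → ∑-cong (λ q → termwise p q)) ⟩
        ∑ (λ p → ∑ (λ q → χ<ᶠ p q * χ< (g q) (g p) + χ<ᶠ p q * (δ posⱼ q * δ posᵢ p)))
          ≡⟨ trans (∑-cong (λ p → ∑-distrib-+ _ _)) (∑-distrib-+ _ _) ⟩
        ∑ (λ p → ∑ (λ q → χ<ᶠ p q * χ< (g q) (g p))) + ∑ (λ p → ∑ (λ q → χ<ᶠ p q * (δ posⱼ q * δ posᵢ p)))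
          ≡⟨ cong₂ _+_ (sym (ℓ≡∑inversions u)) (∑∑-δ posⱼ posᵢ) ⟩
        ℓ u + χ<ᶠ posᵢ posⱼ ∎
      where
      open ≡-Reasoning
      a : ℕ
      a = toℕ i
      g : Fin n → ℕ
      g p = toℕ (u p)
      termwise : ∀ p q → χ<ᶠ p q * χ< (swapℕ a (g q)) (swapℕ a (g p)) + χ<ᶠ p q * (δ posᵢ q * δ posⱼ p)
                       ≡ χ<ᶠ p q * χ< (g q) (g p) + χ<ᶠ p q * (δ posⱼ q * δ posᵢ p)
      termwise p q = begin
          χ<ᶠ p q * χ< (swapℕ a (g q)) (swapℕ a (g p)) + χ<ᶠ p q * (δ posᵢ q * δ posⱼ p)
            ≡⟨ sym (*-distribˡ-+ (χ<ᶠ p q) _ _) ⟩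
          χ<ᶠ p q * (χ< (swapℕ a (g q)) (swapℕ a (g p)) + δ posᵢ q * δ posⱼ p)
            ≡⟨ cong (λ z → χ<ᶠ p q * (χ< (swapℕ a (g q)) (swapℕ a (g p)) + z))
                    (sym (cong₂ _*_ (χ≡-value i q) (trans (cong (χ≡ (g p)) (sym adj)) (χ≡-value j p)))) ⟩
          χ<ᶠ p q * (χ< (swapℕ a (g q)) (swapℕ a (g p)) + χ≡ (g q) a * χ≡ (g p) (suc a))
            ≡⟨ cong (χ<ᶠ p q *_) (χ<-swapℕ a (g q) (g p)) ⟩
          χ<ᶠ p q * (χ< (g q) (g p) + χ≡ (g q) (suc a) * χ≡ (g p) a)
            ≡⟨ cong (λ z → χ<ᶠ p q * (χ< (g q) (g p) + z))
                    (cong₂ _*_ (trans (cong (χ≡ (g q)) (sym adj)) (χ≡-value j q)) (χ≡-value i p)) ⟩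
          χ<ᶠ p q * (χ< (g q) (g p) + δ posⱼ q * δ posᵢ p)
            ≡⟨ *-distribˡ-+ (χ<ᶠ p q) _ _ ⟩
          χ<ᶠ p q * χ< (g q) (g p) + χ<ᶠ p q * (δ posⱼ q * δ posᵢ p) ∎

    ℓ-t∘≤ : ℓ (t ∘ u) ≤ suc (ℓ u)
    ℓ-t∘≤ = ≤-trans (m≤m+n (ℓ (t ∘ u)) (χ<ᶠ posⱼ posᵢ))
      (subst (_≤ suc (ℓ u)) (sym ℓ-t∘-exchange)
        (subst (ℓ u + χ<ᶠ posᵢ posⱼ ≤_) (+-comm (ℓ u) 1) (+-monoʳ-≤ (ℓ u) (χ<≤1 (toℕ posᵢ) (toℕ posⱼ)))))

    ℓ-t∘-descent : χ<ᶠ posⱼ posᵢ ≡ 1 → ℓ (t ∘ u) + 1 ≡ ℓ u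
    ℓ-t∘-descent e = trans (cong (ℓ (t ∘ u) +_) (sym e)) (trans ℓ-t∘-exchange (trans (cong (ℓ u +_) noAscent) (+-identityʳ _)))
      where
      noAscent : χ<ᶠ posᵢ posⱼ ≡ 0
      noAscent = χ<≡0 {toℕ posᵢ} {toℕ posⱼ} (<⇒≤ (χ<≡1⇒< e))

  ℓ-∘t≤ : ∀ (w : Fin n → Fin n) → ℓ (w ∘ t) ≤ suc (ℓ w)
  ℓ-∘t≤ w = begin
      ℓ (w ∘ t)
        ≡⟨ ℓ≡∑inversions (w ∘ t) ⟩
      ∑ (λ p → ∑ (λ q → χ<ᶠ p q * χ< (h (t q)) (h (t p))))
        ≡⟨ trans (∑-permute t t-perm _) (∑-cong (λ p → ∑-permute t t-perm _)) ⟩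
      ∑ (λ p → ∑ (λ q → χ<ᶠ (t p) (t q) * χ< (h (t (t q))) (h (t (t p)))))
        ≡⟨ ∑-cong (λ p → ∑-cong (λ q → cong₂ (λ x y → χ<ᶠ (t p) (t q) * χ< (h x) (h y)) (t-involutive q) (t-involutive p))) ⟩
      ∑ (λ p → ∑ (λ q → χ<ᶠ (t p) (t q) * χ< (h q) (h p)))
        ≤⟨ ∑-mono-≤ (λ p → ∑-mono-≤ (λ q → termwise p q)) ⟩
      ∑ (λ p → ∑ (λ q → χ<ᶠ p q * χ< (h q) (h p) + δ j p * δ i q))
        ≡⟨ trans (∑-cong (λ p → ∑-distrib-+ _ _)) (∑-distrib-+ _ _) ⟩
      ∑ (λ p → ∑ (λ q → χ<ᶠ p q * χ< (h q) (h p))) + ∑ (λ p → ∑ (λ q → δ j p * δ i q))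
        ≡⟨ cong₂ _+_ (sym (ℓ≡∑inversions w))
                     (trans (∑-cong (λ p → trans (∑-*ˡ (δ j p) (δ i)) (trans (cong (δ j p *_) (∑δ≡1 i)) (*-identityʳ _)))) (∑δ≡1 j)) ⟩
      ℓ w + 1
        ≡⟨ +-comm (ℓ w) 1 ⟩
      suc (ℓ w) ∎
    where
    open ≤-Reasoning
    h : Fin n → ℕ
    h p = toℕ (w p)
    χ<ᶠ-t : ∀ p q → χ<ᶠ (t p) (t q) ≤ χ<ᶠ p q + δ j p * δ i q
    χ<ᶠ-t p q = ≤-trans (≤-reflexive (cong₂ χ< (toℕ-t p) (toℕ-t q)))
      (≤-trans (m≤m+n _ _) (≤-reflexive (trans (χ<-swapℕ (toℕ i) (toℕ p) (toℕ q)) (cong (χ<ᶠ p q +_) (cong₂ _*_ δ-j δ-i)))))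
      where
      δ-j : χ≡ (toℕ p) (suc (toℕ i)) ≡ δ j p
      δ-j = trans (cong (χ≡ (toℕ p)) (sym adj)) (χ≡-sym (toℕ p) (toℕ j))
      δ-i : χ≡ (toℕ q) (toℕ i) ≡ δ i q
      δ-i = χ≡-sym (toℕ q) (toℕ i)
    termwise : ∀ p q → χ<ᶠ (t p) (t q) * χ< (h q) (h p) ≤ χ<ᶠ p q * χ< (h q) (h p) + δ j p * δ i q
    termwise p q = ≤-trans (*-monoˡ-≤ (χ< (h q) (h p)) (χ<ᶠ-t p q))
      (≤-trans (≤-reflexive (*-distribʳ-+ (χ< (h q) (h p)) (χ<ᶠ p q) _))
        (+-monoʳ-≤ (χ<ᶠ p q * χ< (h q) (h p)) (≤-trans (*-monoʳ-≤ (δ j p * δ i q) (χ<≤1 (h q) (h p))) (≤-reflexive (*-identityʳ _)))))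

-- The m-action along a word

mAct-conj : ∀ {n} (s : Fin n × Fin n) (π : Fin n → Fin n) → ℓ (sRefl s ∘ π ∘ sRefl s) ≡ ℓ π + 2 → mAct s π ≡ sRefl s ∘ π ∘ sRefl s
mAct-conj s π e rewrite dec-true (ℓ (sRefl s ∘ π ∘ sRefl s) ℕ.≟ ℓ π + 2) e = refl

mAct-fixed : ∀ {n} (s : Fin n × Fin n) (π : Fin n → Fin n) → ℓ (sRefl s ∘ π ∘ sRefl s) ≢ ℓ π + 2 → mAct s π ≡ π
mAct-fixed s π ne rewrite dec-false (ℓ (sRefl s ∘ π ∘ sRefl s) ℕ.≟ ℓ π + 2) ne = refl

ℓ-conjugate-cong : ∀ {n} (s : Fin n × Fin n) {f g : Fin n → Fin n} → f ≐ g → ℓ (sRefl s ∘ f ∘ sRefl s) ≡ ℓ (sRefl s ∘ g ∘ sRefl s)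
ℓ-conjugate-cong s e = ℓ-cong (λ y → cong (sRefl s) (e (sRefl s y)))

mAct-cong : ∀ {n} (s : Fin n × Fin n) {f g : Fin n → Fin n} → f ≐ g → mAct s f ≐ mAct s g
mAct-cong s {f} {g} e x with ℓ (sRefl s ∘ f ∘ sRefl s) ℕ.≟ ℓ f + 2
... | yes q = trans (cong (λ h → h x) (mAct-conj s f q))
  (trans (cong (sRefl s) (e (sRefl s x)))
         (cong (λ h → h x) (sym (mAct-conj s g (trans (sym (ℓ-conjugate-cong s e)) (trans q (cong (_+ 2) (ℓ-cong e))))))))
... | no q = trans (cong (λ h → h x) (mAct-fixed s f q))
  (trans (e x)
         (cong (λ h → h x) (sym (mAct-fixed s g (λ q′ → q (trans (ℓ-conjugate-cong s e) (trans q′ (cong (_+ 2) (sym (ℓ-cong e))))))))))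

-- u is the product of the letters at which m acts by conjugation.
mWordAct-conjugator : ∀ k (ws : List (Fin (k * 2) × Fin (k * 2))) → All Adjacent ws →
  ∃ λ u → IsPerm u × IsConjugator k (mWordAct ws (α′ k)) u × ℓ u ≤ length ws × (ℓ u ≡ length ws → u ≐ wordProd ws)
mWordAct-conjugator k [] [] = id , (λ e → e) , (λ p → refl) , ≤-reflexive (ℓ-id {k * 2}) , (λ _ _ → refl)
mWordAct-conjugator k ((i , j) ∷ ws) (adj ∷ adjs) with mWordAct-conjugator k ws adjs
... | u , u-perm , u-conj , ℓu≤ , tight with ℓ (sRefl (i , j) ∘ mWordAct ws (α′ k) ∘ sRefl (i , j)) ℕ.≟ ℓ (mWordAct ws (α′ k)) + 2
...   | yes acts = t ∘ u , IsPerm-∘ t-perm u-perm , conj′ , ≤-trans ℓ-t∘≤ (s≤s ℓu≤) , tight′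
  where
  open SimpleReflection i j adj
  open LeftMultiplication u u-perm
  conj′ : IsConjugator k (mWordAct ((i , j) ∷ ws) (α′ k)) (t ∘ u)
  conj′ p = trans (cong (λ h → h (t (u p))) (mAct-conj (i , j) (mWordAct ws (α′ k)) acts))
                  (cong t (trans (cong (mWordAct ws (α′ k)) (t-involutive (u p))) (u-conj p)))
  tight′ : ℓ (t ∘ u) ≡ suc (length ws) → (t ∘ u) ≐ wordProd ((i , j) ∷ ws)
  tight′ q x = cong t (tight (≤-antisym ℓu≤ (ℕ.s≤s⁻¹ (subst (_≤ suc (ℓ u)) q ℓ-t∘≤))) x)
...   | no fixes = u , u-perm , conj′ , m≤n⇒m≤1+n ℓu≤ , λ q → ⊥-elim (1+n≰n (subst (_≤ length ws) q ℓu≤))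
  where
  conj′ : IsConjugator k (mWordAct ((i , j) ∷ ws) (α′ k)) u
  conj′ p = trans (cong (λ h → h (u p)) (mAct-fixed (i , j) (mWordAct ws (α′ k)) fixes)) (u-conj p)

module _ (k : ℕ) where
  private
    double-suc : ∀ m → suc m + suc m + k ≡ 2 + (m + m + k)
    double-suc m = cong (λ z → suc z + k) (+-suc m m)

  conjugateAlong : List (Fin (k * 2) × Fin (k * 2)) → Fin (k * 2) → Fin (k * 2)
  conjugateAlong [] = α′ k
  conjugateAlong (s ∷ ws) = sRefl s ∘ conjugateAlong ws ∘ sRefl s

  conjugateAlong-perm : ∀ ws → All Adjacent ws → IsPerm (conjugateAlong ws)
  conjugateAlong-perm [] [] = α′-perm k
  conjugateAlong-perm ((i , j) ∷ ws) (adj ∷ adjs) = IsPerm-∘ t-perm (IsPerm-∘ (conjugateAlong-perm ws adjs) t-perm)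
    where open SimpleReflection i j adj

  conjugateAlong-conjugator : ∀ ws → All Adjacent ws → IsConjugator k (conjugateAlong ws) (wordProd ws)
  conjugateAlong-conjugator [] [] p = refl
  conjugateAlong-conjugator ((i , j) ∷ ws) (adj ∷ adjs) p =
    cong t (trans (cong (conjugateAlong ws) (t-involutive (wordProd ws p))) (conjugateAlong-conjugator ws adjs p))
    where open SimpleReflection i j adj

  ℓ-conjugate-step≤ : ∀ i j ws → (adj : Adjacent (i , j)) → All Adjacent ws →
    ℓ (sRefl (i , j) ∘ conjugateAlong ws ∘ sRefl (i , j)) ≤ 2 + ℓ (conjugateAlong ws)
  ℓ-conjugate-step≤ i j ws adj adjs =
    ≤-trans (LeftMultiplication.ℓ-t∘≤ (conjugateAlong ws ∘ t) (IsPerm-∘ (conjugateAlong-perm ws adjs) t-perm))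
            (s≤s (ℓ-∘t≤ (conjugateAlong ws)))
    where open SimpleReflection i j adj

  ℓ-conjugateAlong≤ : ∀ ws → All Adjacent ws → ℓ (conjugateAlong ws) ≤ length ws + length ws + k
  ℓ-conjugateAlong≤ [] [] = ℓ-α′≤k k
  ℓ-conjugateAlong≤ ((i , j) ∷ ws) (adj ∷ adjs) =
    subst (ℓ (conjugateAlong ((i , j) ∷ ws)) ≤_) (sym (double-suc (length ws)))
          (≤-trans (ℓ-conjugate-step≤ i j ws adj adjs) (s≤s (s≤s (ℓ-conjugateAlong≤ ws adjs))))

  -- When the bound is attained, every step raises ℓ by exactly 2, i.e. m acts by conjugation at every letter.
  conjugateAlong-tight : ∀ ws → All Adjacent ws → ℓ (conjugateAlong ws) ≡ length ws + length ws + k →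
    mWordAct ws (α′ k) ≐ conjugateAlong ws
  conjugateAlong-tight [] [] _ _ = refl
  conjugateAlong-tight ((i , j) ∷ ws) (adj ∷ adjs) tight x =
    trans (mAct-cong (i , j) (conjugateAlong-tight ws adjs tightBefore) x)
          (cong (λ h → h x) (mAct-conj (i , j) c (trans tight (trans (double-suc m) (trans (cong (2 +_) (sym tightBefore)) (+-comm 2 (ℓ c)))))))
    where
    c : Fin (k * 2) → Fin (k * 2)
    c = conjugateAlong ws
    m : ℕ
    m = length ws
    tightBefore : ℓ c ≡ m + m + k
    tightBefore = ≤-antisym (ℓ-conjugateAlong≤ ws adjs)
      (ℕ.s≤s⁻¹ (ℕ.s≤s⁻¹ (subst (_≤ 2 + ℓ c) (trans tight (double-suc m)) (ℓ-conjugate-step≤ i j ws adj adjs))))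

-- Reduced expressions

lower : ∀ {n} (y : Fin n) m → toℕ y ≡ suc m → ∃ λ (x : Fin n) → toℕ x ≡ m
lower {n} y m e = fromℕ< m<n , FP.toℕ-fromℕ< m<n
  where
  m<n : m < n
  m<n = <-trans (n<1+n m) (subst (_< n) e (FP.toℕ<n y))

StepIncreasing : ∀ {n} → (Fin n → Fin n) → Set
StepIncreasing f = ∀ x y → toℕ y ≡ suc (toℕ x) → toℕ (f x) < toℕ (f y)

module _ {n} {f : Fin n → Fin n} (inc : StepIncreasing f) where
  stepIncreasing-inflationary : ∀ m x → toℕ x ≡ m → toℕ x ≤ toℕ (f x)
  stepIncreasing-inflationary zero x e rewrite e = z≤n
  stepIncreasing-inflationary (suc m) x e with lower x m e
  ... | x′ , e′ = subst (_≤ toℕ (f x)) (sym e)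
    (≤-trans (s≤s (subst (_≤ toℕ (f x′)) e′ (stepIncreasing-inflationary m x′ e′))) (inc x′ x (trans e (cong suc (sym e′)))))

  stepIncreasing-mono-< : ∀ x y → toℕ x < toℕ y → toℕ (f x) < toℕ (f y)
  stepIncreasing-mono-< x y p with m≤n⇒∃[o]m+o≡n p
  ... | d , e = byDistance d x y (sym (trans (+-suc (toℕ x) d) e))
    where
    byDistance : ∀ d x y → toℕ y ≡ toℕ x + suc d → toℕ (f x) < toℕ (f y)
    byDistance zero x y e = inc x y (trans e (trans (+-suc (toℕ x) 0) (cong suc (+-identityʳ _))))
    byDistance (suc d) x y e with lower y (toℕ x + suc d) (trans e (+-suc (toℕ x) (suc d)))
    ... | y′ , e′ = <-trans (byDistance d x y′ e′) (inc y′ y (trans e (trans (+-suc (toℕ x) (suc d)) (cong suc (sym e′)))))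

stepIncreasing-perm⇒id : ∀ {n} (f : Fin n → Fin n) → IsPerm f → StepIncreasing f → f ≐ id
stepIncreasing-perm⇒id {n} f f-perm inc x =
  FP.toℕ-injective (≤-antisym f⁻¹-inflationary (stepIncreasing-inflationary inc (toℕ x) x refl))
  where
  f⁻¹ : Fin n → Fin n
  f⁻¹ = inverse f f-perm
  f⁻¹-inc : StepIncreasing f⁻¹
  f⁻¹-inc x y e with <-cmp (toℕ (f⁻¹ x)) (toℕ (f⁻¹ y))
  ... | tri< a _ _ = a
  ... | tri≈ _ b _ = ⊥-elim (1+n≢n (trans (sym e)
    (cong toℕ (trans (sym (inverseʳ f f-perm y)) (trans (cong f (sym (FP.toℕ-injective b))) (inverseʳ f f-perm x))))))
  ... | tri> _ _ c = ⊥-elim (<-asym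
    (subst₂ _<_ (cong toℕ (inverseʳ f f-perm y)) (cong toℕ (inverseʳ f f-perm x)) (stepIncreasing-mono-< inc (f⁻¹ y) (f⁻¹ x) c))
    (subst (toℕ x <_) (sym e) (n<1+n _)))
  f⁻¹-inflationary : toℕ (f x) ≤ toℕ x
  f⁻¹-inflationary = subst (toℕ (f x) ≤_) (cong toℕ (inverseˡ f f-perm x)) (stepIncreasing-inflationary f⁻¹-inc (toℕ (f x)) (f x) refl)

-- Left multiplication by a simple reflection at a descent of w⁻¹ lowers ℓ by one; without descents w⁻¹, hence w, is the identity.
reducedExpression : ∀ {n} m (w : Fin n → Fin n) → IsPerm w → ℓ w ≡ m → ∃ λ ws → IsReducedExpr w ws
reducedExpression {n} m w w-perm e
  with FP.any? (λ i → FP.any? (λ j → (toℕ j ℕ.≟ suc (toℕ i)) ×-dec (χ<ᶠ (inverse w w-perm j) (inverse w w-perm i) ℕ.≟ 1)))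
reducedExpression {n} zero w w-perm e | yes (i , j , adj , descent) =
  ⊥-elim (1+n≢0 (trans (+-comm 1 _) (trans (SimpleReflection.LeftMultiplication.ℓ-t∘-descent i j adj w w-perm descent) e)))
reducedExpression {n} (suc m) w w-perm e | yes (i , j , adj , descent)
  with reducedExpression m (SimpleReflection.t i j adj ∘ w) (IsPerm-∘ (SimpleReflection.t-perm i j adj) w-perm)
         (suc-injective (trans (+-comm 1 _) (trans (SimpleReflection.LeftMultiplication.ℓ-t∘-descent i j adj w w-perm descent) e)))
... | ws , adjs , prod , len = ((i , j) ∷ ws) , (adj ∷ adjs) , prod′ , len′
  where
  open SimpleReflection i j adj
  prod′ : wordProd ((i , j) ∷ ws) ≐ w
  prod′ x = trans (cong t (prod x)) (t-involutive (w x))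
  len′ : suc (length ws) ≡ ℓ w
  len′ = trans (cong suc len) (trans (+-comm 1 _) (LeftMultiplication.ℓ-t∘-descent w w-perm descent))
reducedExpression {n} m w w-perm e | no noDescent = [] , [] , (λ x → sym (w≐id x)) , sym (trans (ℓ-cong w≐id) (ℓ-id {n}))
  where
  w⁻¹ : Fin n → Fin n
  w⁻¹ = inverse w w-perm
  w⁻¹-perm : IsPerm w⁻¹
  w⁻¹-perm {x} {y} q = trans (sym (inverseʳ w w-perm x)) (trans (cong w q) (inverseʳ w w-perm y))
  w⁻¹-inc : StepIncreasing w⁻¹
  w⁻¹-inc x y adj with χ<-cases (toℕ (w⁻¹ y)) (toℕ (w⁻¹ x))
  ... | inj₁ (_ , q) = ⊥-elim (noDescent (x , y , adj , q))
  ... | inj₂ (q , _) = ≤∧≢⇒< q (λ r → 1+n≢n (trans (sym adj) (cong toℕ (w⁻¹-perm (FP.toℕ-injective (sym r))))))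
  w≐id : w ≐ id
  w≐id x = trans (cong w (sym (stepIncreasing-perm⇒id w⁻¹ w⁻¹-perm w⁻¹-inc x))) (inverseʳ w w-perm x)

-- Conditions (1) and (2)

adjacent⇒¬between : ∀ {n} (w : Fin n → Fin n) → IsPerm w → ∀ {P Q : Fin n} {x y z} → toℕ Q ≡ suc (toℕ P) →
  w P ≡ x → w Q ≡ y → ¬ OccursBetween w z y x
adjacent⇒¬between w w-perm {P} {Q} adj wP wQ (inj₁ ((_ , q₂ , e₁ , e₂ , l₁₂) , (_ , _ , e₃ , e₄ , l₃₄))) =
  <-asym (<-trans Q<q₂ q₂<P) (subst (toℕ P <_) (sym adj) (n<1+n _))
  where
  Q<q₂ : toℕ Q < toℕ q₂
  Q<q₂ = subst (_< toℕ q₂) (cong toℕ (w-perm (trans e₁ (sym wQ)))) l₁₂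
  q₂<P : toℕ q₂ < toℕ P
  q₂<P = subst₂ _<_ (cong toℕ (w-perm (trans e₃ (sym e₂)))) (cong toℕ (w-perm (trans e₄ (sym wP)))) l₃₄
adjacent⇒¬between w w-perm {P} {Q} adj wP wQ (inj₂ ((_ , q₂ , e₁ , e₂ , l₁₂) , (_ , _ , e₃ , e₄ , l₃₄))) =
  1+n≰n (≤-trans P<q₂ (ℕ.s≤s⁻¹ (subst (toℕ q₂ <_) adj q₂<Q)))
  where
  P<q₂ : toℕ P < toℕ q₂
  P<q₂ = subst (_< toℕ q₂) (cong toℕ (w-perm (trans e₁ (sym wP)))) l₁₂
  q₂<Q : toℕ q₂ < toℕ Q
  q₂<Q = subst₂ _<_ (cong toℕ (w-perm (trans e₃ (sym e₂)))) (cong toℕ (w-perm (trans e₄ (sym wQ)))) l₃₄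

module _ (k : ℕ) (π w : Fin (k * 2) → Fin (k * 2)) (w-perm : IsPerm w) (w-conj : IsConjugator k π w) where
  open BlockSums k π w w-perm w-conj

  π-even : ∀ j → π (w (even j)) ≡ w (odd j)
  π-even j = trans (w-conj (even j)) (cong w (α′-even j))

  π-odd : ∀ j → π (w (odd j)) ≡ w (even j)
  π-odd j = trans (w-conj (odd j)) (cong w (α′-odd j))

  pairInBlock : BlocksIncreasing → ∀ a → a F.< π a → ∃ λ j → w (even j) ≡ a × w (odd j) ≡ π a
  pairInBlock inc a a<πa with even-or-odd {k} (inverse w w-perm a)
  ... | j , inj₁ e = j , wEven , trans (sym (π-even j)) (cong π wEven)
    where
    wEven : w (even j) ≡ a
    wEven = trans (cong w (sym e)) (inverseʳ w w-perm a)
  ... | j , inj₂ e = ⊥-elim (<-asym (inc j) (subst₂ _<_ (cong toℕ (sym wOdd)) (cong toℕ (trans (cong π (sym wOdd)) (π-odd j))) a<πa))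
    where
    wOdd : w (odd j) ≡ a
    wOdd = trans (cong w (sym e)) (inverseʳ w w-perm a)

  blocks⇒Cond1 : BlocksIncreasing → Cond1 π w
  blocks⇒Cond1 inc a a<πa with pairInBlock inc a a<πa
  ... | j , wEven , wOdd = (even j , odd j , wEven , wOdd , even<odd j) , (λ _ → adjacent⇒¬between w w-perm (odd≡suc-even j) wEven wOdd)

  blocks⇒Cond2 : BlocksIncreasing → NoDominatedBlock → Cond2 π w
  blocks⇒Cond2 inc nd a a′ a<πa a′<πa′ a<a′ πa<πa′ with pairInBlock inc a a<πa | pairInBlock inc a′ a′<πa′
  ... | j , wEven , wOdd | j′ , wEven′ , wOdd′ with <-cmp (toℕ j) (toℕ j′)
  ...   | tri< j<j′ _ _ = odd j , even j′ , wOdd , wEven′ , odd<even j j′ j<j′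
  ...   | tri≈ _ j≡j′ _ = ⊥-elim (<-irrefl (cong toℕ (trans (sym wEven) (trans (cong (w ∘ even) (FP.toℕ-injective j≡j′)) wEven′))) a<a′)
  ...   | tri> _ _ j′<j = ⊥-elim (nd j′ j j′<j (subst₂ _<_ (cong toℕ (sym wEven)) (cong toℕ (sym wEven′)) a<a′ ,
                                              subst₂ _<_ (cong toℕ (sym wOdd)) (cong toℕ (sym wOdd′)) πa<πa′))

module _ (k : ℕ) (π w : Fin (k * 2) → Fin (k * 2)) (π-fpf : IsFPFInvolution π) (w-perm : IsPerm w) (cond1 : Cond1 π w) where
  Cond1⇒adjacent : ∀ a → a F.< π a → ∀ P P′ → w P ≡ a → w P′ ≡ π a → toℕ P′ ≡ suc (toℕ P)
  Cond1⇒adjacent a a<πa P P′ wP wP′ with cond1 a a<πa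
  ... | (q₁ , q₂ , e₁ , e₂ , q₁<q₂) , nothingBetween = ≤-antisym P′≤1+P P<P′
    where
    P<P′ : suc (toℕ P) ≤ toℕ P′
    P<P′ = subst₂ _<_ (cong toℕ (w-perm (trans e₁ (sym wP)))) (cong toℕ (w-perm (trans e₂ (sym wP′)))) q₁<q₂
    P′≤1+P : toℕ P′ ≤ suc (toℕ P)
    P′≤1+P with suc (toℕ P) ℕ.<? toℕ P′
    ... | no q = ≮⇒≥ q
    ... | yes q = ⊥-elim (nothingBetween (w r) (inj₂ ((P , r , wP , refl , P<r) , (r , P′ , refl , wP′ , r<P′))))
      where
      r : Fin (k * 2)
      r = fromℕ< (<-trans q (FP.toℕ<n P′))
      P<r : toℕ P < toℕ r
      P<r = subst (toℕ P <_) (sym (FP.toℕ-fromℕ< (<-trans q (FP.toℕ<n P′)))) (n<1+n _)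
      r<P′ : toℕ r < toℕ P′
      r<P′ = subst (_< toℕ P′) (sym (FP.toℕ-fromℕ< (<-trans q (FP.toℕ<n P′)))) q

  private
    partner : Fin (k * 2) → Fin (k * 2)
    partner p = inverse w w-perm (π (w p))

    w-partner : ∀ p → w (partner p) ≡ π (w p)
    w-partner p = inverseʳ w w-perm (π (w p))

    partner-adjacent : ∀ p → toℕ (partner p) ≡ suc (toℕ p) ⊎ toℕ p ≡ suc (toℕ (partner p))
    partner-adjacent p with <-cmp (toℕ (w p)) (toℕ (π (w p)))
    ... | tri< c _ _ = inj₁ (Cond1⇒adjacent (w p) c p (partner p) refl (w-partner p))
    ... | tri≈ _ c _ = ⊥-elim (proj₂ π-fpf (w p) (sym (FP.toℕ-injective c)))
    ... | tri> _ _ c = inj₂ (Cond1⇒adjacent (π (w p)) (subst (toℕ (π (w p)) <_) (cong toℕ (sym (proj₁ π-fpf (w p)))) c)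
                                           (partner p) p (w-partner p) (sym (proj₁ π-fpf (w p))))

    partner-involutive : ∀ p → partner (partner p) ≡ p
    partner-involutive p = w-perm (trans (w-partner (partner p)) (trans (cong π (w-partner p)) (proj₁ π-fpf (w p))))

    -- Induction along the blocks: position 2j cannot be paired with 2j-1, which is already paired with 2j-2.
    partner-even : ∀ m (j : Fin k) → toℕ j ≡ m → partner (even j) ≡ odd j
    partner-even m j ej with partner-adjacent (even j)
    ... | inj₁ e = FP.toℕ-injective (trans e (sym (odd≡suc-even j)))
    partner-even zero j ej | inj₂ e = ⊥-elim (1+n≢0 (trans (sym e) (trans (toℕ-even j) (cong (λ z → z + z) ej))))
    partner-even (suc m) j ej | inj₂ e with lower j m ej
    ... | j′ , ej′ = ⊥-elim (1+n≢n (trans (sym ej) (trans (cong toℕ (even-injective sameEven)) ej′)))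
      where
      partnerIsOdd : partner (even j) ≡ odd j′
      partnerIsOdd = FP.toℕ-injective (suc-injective (trans (sym e) (trans (toℕ-even j) (trans (cong (λ z → z + z) ej)
        (trans (cong suc (+-suc m m)) (cong suc (trans (cong (λ z → suc (z + z)) (sym ej′)) (sym (toℕ-odd j′)))))))))
      sameEven : even j ≡ even j′
      sameEven = trans (sym (partner-involutive (even j)))
        (trans (cong partner partnerIsOdd) (trans (cong partner (sym (partner-even m j′ ej′))) (partner-involutive (even j′))))

    partner-odd : ∀ (j : Fin k) → partner (odd j) ≡ even j
    partner-odd j = trans (cong partner (sym (partner-even (toℕ j) j refl))) (partner-involutive (even j))

  Cond1⇒conjugator : IsConjugator k π w
  Cond1⇒conjugator p with even-or-odd {k} p
  ... | j , inj₁ refl = trans (sym (w-partner (even j))) (cong w (trans (partner-even (toℕ j) j refl) (sym (α′-even j))))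
  ... | j , inj₂ refl = trans (sym (w-partner (odd j))) (cong w (trans (partner-odd j) (sym (α′-odd j))))

  open BlockSums k π w w-perm Cond1⇒conjugator

  private
    π-w-even : ∀ j → π (w (even j)) ≡ w (odd j)
    π-w-even = π-even k π w w-perm Cond1⇒conjugator

    π-w-odd : ∀ j → π (w (odd j)) ≡ w (even j)
    π-w-odd = π-odd k π w w-perm Cond1⇒conjugator

  Cond1⇒BlocksIncreasing : BlocksIncreasing
  Cond1⇒BlocksIncreasing j with <-cmp (u₀ j) (u₁ j)
  ... | tri< c _ _ = c
  ... | tri≈ _ c _ = ⊥-elim (u₀≢u₁ j c)
  ... | tri> _ _ c = ⊥-elim (<-irrefl refl (subst (toℕ (even j) <_) twoApart (<-trans (n<1+n _) (n<1+n _))))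
    where
    twoApart : suc (suc (toℕ (even j))) ≡ toℕ (even j)
    twoApart = trans (cong suc (sym (odd≡suc-even j)))
      (sym (Cond1⇒adjacent (w (odd j)) (subst (u₁ j <_) (cong toℕ (sym (π-w-odd j))) c) (odd j) (even j) refl (sym (π-w-odd j))))

  opensAtEven : ∀ j → w (even j) F.< π (w (even j))
  opensAtEven j = subst (u₀ j <_) (cong toℕ (sym (π-w-even j))) (Cond1⇒BlocksIncreasing j)

  Cond2⇒NoDominatedBlock : Cond2 π w → NoDominatedBlock
  Cond2⇒NoDominatedBlock cond2 j j′ j<j′ (a′<a , b′<b)
    with cond2 (w (even j′)) (w (even j)) (opensAtEven j′) (opensAtEven j) a′<a
               (subst₂ _<_ (cong toℕ (sym (π-w-even j′))) (cong toℕ (sym (π-w-even j))) b′<b)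
  ... | q₁ , q₂ , e₁ , e₂ , q₁<q₂ =
    <-asym (even<odd′ j j′ j<j′) (subst₂ _<_ (cong toℕ (w-perm (trans e₁ (π-w-even j′)))) (cong toℕ (w-perm e₂)) q₁<q₂)

InW′⇒conditions : ∀ k (π w : Fin (k * 2) → Fin (k * 2)) → IsPerm w → InW′ k π w → Cond1 π w × Cond2 π w
InW′⇒conditions k π w w-perm (_ , (ws , (adjs , prod , len) , act) , ℓw≡L′)
  with mWordAct-conjugator k ws adjs
... | u , u-perm , u-conj , ℓu≤len , tight =
  blocks⇒Cond1 k π w w-perm w-conj increasing , blocks⇒Cond2 k π w w-perm w-conj increasing (L′≡ℓ⇒NoDominatedBlock (sym ℓw≡L′))
  where
  π-conj-u : IsConjugator k π u
  π-conj-u p = trans (sym (act (u p))) (u-conj p)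
  u≐w : u ≐ w
  u≐w x = trans (tight (≤-antisym ℓu≤len (subst (_≤ ℓ u) (trans (sym ℓw≡L′) (sym len)) (BlockSums.L′≤ℓ k π u u-perm π-conj-u))) x) (prod x)
  w-conj : IsConjugator k π w
  w-conj p = trans (cong π (sym (u≐w p))) (trans (π-conj-u p) (u≐w (α′ k p)))
  open BlockSums k π w w-perm w-conj
  increasing : BlocksIncreasing
  increasing = L′≡ℓ⇒BlocksIncreasing (sym ℓw≡L′)

conditions⇒InW′ : ∀ k (π w : Fin (k * 2) → Fin (k * 2)) → IsFPFInvolution π → IsPerm w → Cond1 π w × Cond2 π w → InW′ k π w
conditions⇒InW′ k π w π-fpf w-perm (cond1 , cond2) with reducedExpression (ℓ w) w w-perm refl
... | ws , adjs , prod , len = w-perm , (ws , (adjs , prod , len) , act) , ℓ≡L′ increasing noDomination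
  where
  w-conj : IsConjugator k π w
  w-conj = Cond1⇒conjugator k π w π-fpf w-perm cond1
  open BlockSums k π w w-perm w-conj
  increasing : BlocksIncreasing
  increasing = Cond1⇒BlocksIncreasing k π w π-fpf w-perm cond1
  noDomination : NoDominatedBlock
  noDomination = Cond2⇒NoDominatedBlock k π w π-fpf w-perm cond1 cond2
  conjugateAlong≐π : conjugateAlong k ws ≐ π
  conjugateAlong≐π = ≐-from-image w-perm λ p →
    trans (cong (conjugateAlong k ws) (sym (prod p)))
      (trans (conjugateAlong-conjugator k ws adjs p) (trans (prod (α′ k p)) (sym (w-conj p))))
  attained : ℓ (conjugateAlong k ws) ≡ length ws + length ws + k
  attained = ≤-antisym (ℓ-conjugateAlong≤ k ws adjs)
    (subst₂ _≤_ (cong (λ m → m + m + k) (sym len)) (sym (ℓ-cong conjugateAlong≐π)) (2ℓ+k≤ℓπ increasing noDomination))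
  act : mWordAct ws (α′ k) ≐ π
  act x = trans (conjugateAlong-tight k ws adjs attained x) (conjugateAlong≐π x)

corollary2p13 : (k : ℕ) (π : Fin (k * 2) → Fin (k * 2)) → IsFPFInvolution π →
    (w : Fin (k * 2) → Fin (k * 2)) → IsPerm w →
    InW′ k π w ⇔ (Cond1 π w × Cond2 π w)
corollary2p13 k π π-fpf w w-perm = mk⇔ (InW′⇒conditions k π w w-perm) (conditions⇒InW′ k π w π-fpf w-perm)
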